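{- For the wheel $W_n$ of order $n+1\geq 4$, \[ \chi_d^t(C(W_n))=\begin{cases}\lfloor 2n/3\rfloor +3 & \text{if } n\equiv 0 \pmod 3 \text{ and } n\neq 3,\\ \lfloor 2n/3\rfloor +4 & \text{otherwise}.\end{cases} \]
   Context: The wheel $W_n$ is the graph of order $n+1$ obtained from a cycle $v_1v_2\cdots v_n v_1$ by adding a vertex $v_0$ adjacent to all of $v_1,\dots,v_n$. For a graph $G=(V,E)$ with $V=\{v_1,\dots,v_n\}$, the central graph $C(G)$ is the graph with vertex set $V\cup\{c_{ij} : v_iv_j\in E\}$ obtained by subdividing each edge $v_iv_j$ of $G$ exactly once by a new vertex $c_{ij}$ (adjacent to exactly $v_i$ and $v_j$) and joining every pair of distinct vertices non-adjacent in $G$. A total dominator coloring (TDC) of a graph $H$ with no isolated vertices is a proper vertex coloring of $H$ in which every vertex is adjacent to all vertices of some color class. $\chi_d^t(H)$ is the minimum number of color classes in a TDC of $H$. -}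

module Defs where

open import Data.Nat using (ℕ; zero; suc; _<_; _≡ᵇ_)
open import Data.Bool using (Bool; true; false; _∧_; _∨_; not)
open import Data.Fin using (Fin; toℕ)
open import Data.Product using (Σ; ∃; _×_; _,_; proj₁; proj₂)
open import Data.Sum using (_⊎_; inj₁; inj₂)
open import Data.Empty using (⊥)
open import Relation.Binary.PropositionalEquality using (_≡_; _≢_)
open import Relation.Nullary using (¬_)

record Graph : Set₁ where
  field
    V : Set
    E : V → V → Set

open Graph public

-- Wheel W_n on vertices Fin (suc n): vertex 0 is the hub v₀, vertex i (1 ≤ i ≤ n)
-- is the rim vertex v_i; rim cycle v₁ v₂ ⋯ v_n v₁.
wheelAdjℕ : ℕ → ℕ → ℕ → Bool
wheelAdjℕ n x y =
  ((x ≡ᵇ 0) ∧ not (y ≡ᵇ 0)) ∨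
  ((y ≡ᵇ 0) ∧ not (x ≡ᵇ 0)) ∨
  (not (x ≡ᵇ 0) ∧ not (y ≡ᵇ 0) ∧
    ((y ≡ᵇ suc x) ∨ (x ≡ᵇ suc y) ∨ ((x ≡ᵇ n) ∧ (y ≡ᵇ 1)) ∨ ((y ≡ᵇ n) ∧ (x ≡ᵇ 1))))

wheelAdj : (n : ℕ) → Fin (suc n) → Fin (suc n) → Bool
wheelAdj n a b = wheelAdjℕ n (toℕ a) (toℕ b)

-- Edges of a simple graph on Fin m (Bool adjacency), each edge listed once as i < j.
EdgeOf : (m : ℕ) → (Fin m → Fin m → Bool) → Set
EdgeOf m adj = Σ (Fin m × Fin m) λ p → (toℕ (proj₁ p) < toℕ (proj₂ p)) × (adj (proj₁ p) (proj₂ p) ≡ true)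

-- Central graph C(G): original vertices plus one subdivision vertex c_ij per edge v_iv_j;
-- c_ij adjacent exactly to v_i and v_j; distinct original vertices adjacent iff
-- non-adjacent in G; subdivision vertices pairwise non-adjacent.
centralE : (m : ℕ) (adj : Fin m → Fin m → Bool) →
           (Fin m ⊎ EdgeOf m adj) → (Fin m ⊎ EdgeOf m adj) → Set
centralE m adj (inj₁ u) (inj₁ v) = (u ≢ v) × (adj u v ≡ false)
centralE m adj (inj₁ u) (inj₂ ((i , j) , _)) = (u ≡ i) ⊎ (u ≡ j)
centralE m adj (inj₂ ((i , j) , _)) (inj₁ u) = (u ≡ i) ⊎ (u ≡ j)
centralE m adj (inj₂ _) (inj₂ _) = ⊥

Central : (m : ℕ) → (Fin m → Fin m → Bool) → Graph
Central m adj = record { V = Fin m ⊎ EdgeOf m adj ; E = centralE m adj }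

-- Total dominator coloring with (at most) k colors: proper, and every vertex is
-- adjacent to all vertices of some (nonempty) color class.
IsTDC : (G : Graph) (k : ℕ) → (V G → Fin k) → Set
IsTDC G k c =
  (∀ u v → E G u v → c u ≢ c v) ×
  (∀ u → ∃ λ (i : Fin k) → (∃ λ w → c w ≡ i) × (∀ w → c w ≡ i → E G u w))

HasTDC : Graph → ℕ → Set
HasTDC G k = ∃ λ (c : V G → Fin k) → IsTDC G k c

TDChromatic : Graph → ℕ → Set
TDChromatic G k = HasTDC G k × (∀ j → j < k → ¬ HasTDC G j)

-- In C(Wₙ) the hub is adjacent only to the spoke subdivision vertices, and two rim vertices
-- are adjacent unless they are consecutive, so a rim colour class is a single vertex or a
-- consecutive pair.  Every subdivision vertex dominates a colour class inside its two
-- endpoints, and the hub dominates a class of spoke subdivision vertices, whose colour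
-- appears on no original vertex.
--
-- If the hub shares its colour, the spoke subdivision vertices force all rim
-- colours to be distinct, so χ ≥ n + 2.  Otherwise sort the rim vertices into first and
-- second vertices of pairs, vertices whose class is dominated by an incident rim subdivision
-- vertex, and the remaining lonely ones.  Going back one step injects second vertices into
-- first ones, and going forward two steps from first vertices and one step from lonely ones
-- injects both into the dominated vertices.  So the number D of rim colours satisfies
-- 3D ≥ 2n + 2·#lonely.  Either some rim subdivision vertex has a colour not on the rim, and
-- χ ≥ D + 3, or each shares the colour of a rim vertex, which is then lonely, and χ ≥ D + 2
-- with at least two lonely vertices; both give 3χ ≥ 2n + 9.  For n = 3 the graph is the
-- subdivided K₄, and a direct case analysis gives χ ≥ 6.
--
-- For n = 3q + r with q ≥ 2, colour the rim in blocks vₖ vₖ₊₁ | vₖ₊₂ followed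
-- by r singletons and add one colour each for the hub, the spoke subdivision vertices and
-- the rim subdivision vertices: 2q + r + 3 colours.  W₃, W₄ and W₅ are coloured by hand and
-- the colourings are checked by evaluation.

module Submission where

open import Data.Bool using (Bool; true; false; T; _∧_; _∨_; not; if_then_else_)
open import Data.Bool.Properties as Bool using (∧-identityʳ; ∨-zeroʳ; T-∧; T-∨; T-≡; T-not-≡)
open import Data.Empty using (⊥; ⊥-elim)
open import Data.Fin using (Fin; zero; suc; toℕ; fromℕ<; #_)
open import Data.Fin.Properties using (toℕ-injective; toℕ-fromℕ<; toℕ<n; suc-injective; 0≢1+n; _≟_; any?; all?; ¬∀⟶∃¬)
open import Data.List using (List; []; _∷_; length)
open import Data.List.Properties using (length-++)
open import Data.List.Relation.Unary.All as All using (All; []; _∷_)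
open import Data.List.Relation.Unary.AllPairs using (AllPairs; []; _∷_)
open import Data.List.Relation.Unary.AllPairs.Properties using (++⁺)
import Data.Nat as ℕ
open import Data.Nat using (ℕ; zero; suc; _+_; _*_; _∸_; _≤_; _<_; z≤n; s≤s; s≤s⁻¹; _≡ᵇ_; _<?_)
open import Data.Nat.DivMod
  using (_/_; _%_; _mod_; %-distribˡ-+; m%n%n≡m%n; [m+n]%n≡m%n; [m+kn]%n≡m%n; m<n⇒m%n≡m; n%n≡0; m≤n⇒[n∸m]%m≡n%m;
         m≡m%n+[m/n]*n; m<n*o⇒m/o<n; m%n<n; /-monoˡ-≤; +-distrib-/-∣ʳ; m*n/n≡m)
open import Data.Nat.Divisibility using (divides)
import Data.Nat.Properties as ℕₚ
open import Data.Nat.Properties hiding (_≟_; suc-injective; 0≢1+n)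
open import Data.Nat.Tactic.RingSolver using (solve-∀)
open import Data.Product using (_×_; _,_; proj₁; proj₂; ∃; Σ)
open import Data.Sum using (_⊎_; inj₁; inj₂)
open import Data.Vec using (lookup; []; _∷_)
open import Function using (_∘_; _$_; Equivalence)
open import Relation.Binary using (tri<; tri≈; tri>)
open import Relation.Binary.PropositionalEquality
open import Relation.Nullary using (¬_; ¬?; Dec; does; yes; no; _⊎-dec_; _×-dec_)
open import Relation.Nullary.Decidable using (dec-false; True; toWitness; from-yes; _→-dec_)

open import Defs

open Equivalence using (to; from)

count : ∀ {n} → (Fin n → Bool) → ℕ
count {zero} P = 0
count {suc n} P = (if P zero then 1 else 0) + count (P ∘ suc)

count-cong : ∀ {n} {P Q : Fin n → Bool} → (∀ i → P i ≡ Q i) → count P ≡ count Q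
count-cong {zero} P≡Q = refl
count-cong {suc n} P≡Q = cong₂ _+_ (cong (λ b → if b then 1 else 0) (P≡Q zero)) (count-cong (P≡Q ∘ suc))

count-true : ∀ n → count {n} (λ _ → true) ≡ n
count-true zero = refl
count-true (suc n) = cong suc (count-true n)

_without_ : ∀ {n} → (Fin n → Bool) → Fin n → Fin n → Bool
(P without a) y = P y ∧ not (does (y ≟ a))

count-remove : ∀ {n} (P : Fin n → Bool) {a} → T (P a) → count P ≡ suc (count (P without a))
count-remove {suc n} P {zero} Pa with P zero
... | true = cong suc (count-cong (λ i → sym (∧-identityʳ (P (suc i)))))
count-remove {suc n} P {suc a} Pa with P zero
... | true = cong suc (count-remove (P ∘ suc) Pa)
... | false = count-remove (P ∘ suc) Pa

count-injective-≤ : ∀ {m n} (P : Fin m → Bool) (Q : Fin n → Bool) (f : Fin m → Fin n) →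
  (∀ {i} → T (P i) → T (Q (f i))) →
  (∀ {i k} → T (P i) → T (P k) → f i ≡ f k → i ≡ k) →
  count P ≤ count Q
count-injective-≤ {zero} P Q f pres inj = z≤n
count-injective-≤ {suc m} P Q f pres inj with P zero in P₀
... | false = count-injective-≤ (P ∘ suc) Q (f ∘ suc) pres (λ p q → suc-injective ∘ inj p q)
... | true rewrite count-remove Q (pres (from T-≡ P₀)) =
  s≤s (count-injective-≤ (P ∘ suc) (Q without f zero) (f ∘ suc)
         (λ p → from T-∧ (pres p , from T-not-≡ (dec-false (f _ ≟ f zero)
                    (λ f₁≡f₀ → 0≢1+n (inj (from T-≡ P₀) p (sym f₁≡f₀))))))
         (λ p q → suc-injective ∘ inj p q))

avoids : ∀ {n} → List (Fin n) → Fin n → Bool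
avoids [] y = true
avoids (c ∷ cs) y = (avoids cs without c) y

avoids-all : ∀ {n} {y : Fin n} {cs} → All (y ≢_) cs → T (avoids cs y)
avoids-all [] = _
avoids-all (y≢c ∷ y∉cs) = from T-∧ (avoids-all y∉cs , from T-not-≡ (dec-false (_ ≟ _) y≢c))

count-avoids : ∀ {n} {cs : List (Fin n)} → AllPairs _≢_ cs → count (avoids cs) + length cs ≡ n
count-avoids {n} [] = trans (+-identityʳ _) (count-true n)
count-avoids {n} {c ∷ cs} (c∉cs ∷ distinct) = begin
  count (avoids (c ∷ cs)) + suc (length cs) ≡⟨ +-suc _ _ ⟩
  suc (count (avoids (c ∷ cs))) + length cs ≡⟨ cong (_+ length cs) (sym (count-remove (avoids cs) (avoids-all c∉cs))) ⟩
  count (avoids cs) + length cs            ≡⟨ count-avoids distinct ⟩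
  n                                        ∎
  where open ≡-Reasoning

count-≤-avoiding : ∀ {m n} (P : Fin m → Bool) (f : Fin m → Fin n) {cs : List (Fin n)} → AllPairs _≢_ cs →
  (∀ {i} → T (P i) → All (f i ≢_) cs) →
  (∀ {i k} → T (P i) → T (P k) → f i ≡ f k → i ≡ k) →
  count P + length cs ≤ n
count-≤-avoiding {n = n} P f {cs} distinct avoid inj = begin
  count P + length cs           ≤⟨ +-monoˡ-≤ (length cs) (count-injective-≤ P (avoids cs) f (avoids-all ∘ avoid) inj) ⟩
  count (avoids cs) + length cs ≡⟨ count-avoids distinct ⟩
  n                             ∎
  where open ≤-Reasoning

length-distinct-≤ : ∀ {n} {cs : List (Fin n)} → AllPairs _≢_ cs → length cs ≤ n
length-distinct-≤ {cs = cs} distinct = subst (length cs ≤_) (count-avoids distinct) (m≤n+m (length cs) _)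

two≤count : ∀ {n} (P : Fin n → Bool) {a b} → T (P a) → T (P b) → b ≢ a → 2 ≤ count P
two≤count P {a} Pa Pb b≢a
  rewrite count-remove P Pa | count-remove (P without a) (from T-∧ (Pb , from T-not-≡ (dec-false (_ ≟ a) b≢a))) =
  s≤s (s≤s z≤n)

2[a+b+c+d]+2d≤3[a+c+d] : ∀ a b c d → b ≤ a → a + d ≤ c → 2 * (a + b + c + d) + 2 * d ≤ 3 * (a + c + d)
2[a+b+c+d]+2d≤3[a+c+d] a b c d b≤a a+d≤c = begin
  2 * (a + b + c + d) + 2 * d             ≡⟨ regroup a b c d ⟩
  (2 * a + 2 * c + 3 * d) + (b + (b + d)) ≤⟨ +-monoʳ-≤ (2 * a + 2 * c + 3 * d)
                                                  (+-mono-≤ b≤a (≤-trans (+-monoˡ-≤ d b≤a) a+d≤c)) ⟩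
  (2 * a + 2 * c + 3 * d) + (a + c)       ≡⟨ collect a c d ⟩
  3 * (a + c + d)                         ∎
  where
  open ≤-Reasoning
  regroup : ∀ a b c d → 2 * (a + b + c + d) + 2 * d ≡ (2 * a + 2 * c + 3 * d) + (b + (b + d))
  regroup = solve-∀
  collect : ∀ a c d → (2 * a + 2 * c + 3 * d) + (a + c) ≡ 3 * (a + c + d)
  collect = solve-∀

2n+9≤3[n+2] : ∀ {n} → 3 ≤ n → 2 * n + 9 ≤ 3 * (n + 2)
2n+9≤3[n+2] {n} 3≤n = begin
  2 * n + 9       ≡⟨ +-assoc (2 * n) 6 3 ⟨
  2 * n + 6 + 3   ≤⟨ +-monoʳ-≤ (2 * n + 6) 3≤n ⟩
  2 * n + 6 + n   ≡⟨ collect n ⟩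
  3 * (n + 2)     ∎
  where
  open ≤-Reasoning
  collect : ∀ n → 2 * n + 6 + n ≡ 3 * (n + 2)
  collect = solve-∀

-- Classifying rim vertices

data Kind : Set where
  pairStart pairEnd dominated lonely : Kind

is : Kind → Kind → Bool
is pairStart pairStart = true
is pairEnd   pairEnd   = true
is dominated dominated = true
is lonely    lonely    = true
is _         _         = false

tally : ∀ {n} → Kind → (Fin n → Kind) → ℕ
tally κ f = count (λ k → is κ (f k))

tally-partition : ∀ {n} (f : Fin n → Kind) →
  n ≡ tally pairStart f + tally pairEnd f + tally dominated f + tally lonely f
tally-partition {zero} f = refl
tally-partition {suc n} f with tally-partition (f ∘ suc) | f zero
... | IH | pairStart = cong suc IH
... | IH | pairEnd   = trans (cong suc IH) (cong (λ z → z + tally dominated (f ∘ suc) + tally lonely (f ∘ suc))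
                                             (sym (+-suc (tally pairStart (f ∘ suc)) (tally pairEnd (f ∘ suc)))))
... | IH | dominated = trans (cong suc IH) (cong (_+ tally lonely (f ∘ suc))
                                             (sym (+-suc (tally pairStart (f ∘ suc) + tally pairEnd (f ∘ suc)) _)))
... | IH | lonely    = trans (cong suc IH) (sym (+-suc _ (tally lonely (f ∘ suc))))

tally-not-pairEnd : ∀ {n} (f : Fin n → Kind) →
  count (λ k → not (is pairEnd (f k))) ≡ tally pairStart f + tally dominated f + tally lonely f
tally-not-pairEnd {zero} f = refl
tally-not-pairEnd {suc n} f with tally-not-pairEnd (f ∘ suc) | f zero
... | IH | pairStart = cong suc IH
... | IH | pairEnd   = IH
... | IH | dominated = trans (cong suc IH) (cong (_+ tally lonely (f ∘ suc))
                                             (sym (+-suc (tally pairStart (f ∘ suc)) (tally dominated (f ∘ suc)))))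
... | IH | lonely    = trans (cong suc IH) (sym (+-suc _ (tally lonely (f ∘ suc))))

tally-start-or-lonely : ∀ {n} (f : Fin n → Kind) →
  count (λ k → is pairStart (f k) ∨ is lonely (f k)) ≡ tally pairStart f + tally lonely f
tally-start-or-lonely {zero} f = refl
tally-start-or-lonely {suc n} f with tally-start-or-lonely (f ∘ suc) | f zero
... | IH | pairStart = cong suc IH
... | IH | pairEnd   = IH
... | IH | dominated = IH
... | IH | lonely    = trans (cong suc IH) (sym (+-suc (tally pairStart (f ∘ suc)) (tally lonely (f ∘ suc))))

module _ {a b c} {A : Set a} {B : Set b} {C : Set c} where

  classify : Dec A → Dec B → Dec C → Kind
  classify (yes _) _       _       = pairStart
  classify (no _)  (yes _) _       = pairEnd
  classify (no _)  (no _)  (yes _) = dominated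
  classify (no _)  (no _)  (no _)  = lonely

  variable
    a? : Dec A
    b? : Dec B
    c? : Dec C

  classify-pairStart : A → T (is pairStart (classify a? b? c?))
  classify-pairStart {a? = yes _} _ = _
  classify-pairStart {a? = no ¬a} a = ⊥-elim (¬a a)

  classify-pairStart⁻ : T (is pairStart (classify a? b? c?)) → A
  classify-pairStart⁻ {a? = yes a} _ = a
  classify-pairStart⁻ {a? = no _} {b? = yes _} ()
  classify-pairStart⁻ {a? = no _} {b? = no _} {c? = yes _} ()
  classify-pairStart⁻ {a? = no _} {b? = no _} {c? = no _} ()

  classify-pairEnd⁻ : T (is pairEnd (classify a? b? c?)) → B
  classify-pairEnd⁻ {a? = yes _} ()
  classify-pairEnd⁻ {a? = no _} {b? = yes b} _ = b
  classify-pairEnd⁻ {a? = no _} {b? = no _} {c? = yes _} ()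
  classify-pairEnd⁻ {a? = no _} {b? = no _} {c? = no _} ()

  classify-not-pairEnd⁻ : T (not (is pairEnd (classify a? b? c?))) → A ⊎ ¬ B
  classify-not-pairEnd⁻ {a? = yes a} _ = inj₁ a
  classify-not-pairEnd⁻ {a? = no _} {b? = yes _} ()
  classify-not-pairEnd⁻ {a? = no _} {b? = no ¬b} {c? = yes _} _ = inj₂ ¬b
  classify-not-pairEnd⁻ {a? = no _} {b? = no ¬b} {c? = no _} _ = inj₂ ¬b

  classify-dominated : ¬ A → ¬ B → C → T (is dominated (classify a? b? c?))
  classify-dominated {a? = yes a} ¬a _ _ = ⊥-elim (¬a a)
  classify-dominated {a? = no _} {b? = yes b} _ ¬b _ = ⊥-elim (¬b b)
  classify-dominated {a? = no _} {b? = no _} {c? = yes _} _ _ _ = _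
  classify-dominated {a? = no _} {b? = no _} {c? = no ¬c} _ _ c = ⊥-elim (¬c c)

  classify-lonely : ¬ A → ¬ B → ¬ C → T (is lonely (classify a? b? c?))
  classify-lonely {a? = yes a} ¬a _ _ = ⊥-elim (¬a a)
  classify-lonely {a? = no _} {b? = yes b} _ ¬b _ = ⊥-elim (¬b b)
  classify-lonely {a? = no _} {b? = no _} {c? = yes c} _ _ ¬c = ⊥-elim (¬c c)
  classify-lonely {a? = no _} {b? = no _} {c? = no _} _ _ _ = _

  classify-lonely⁻ : T (is lonely (classify a? b? c?)) → ¬ A × ¬ B × ¬ C
  classify-lonely⁻ {a? = yes _} ()
  classify-lonely⁻ {a? = no _} {b? = yes _} ()
  classify-lonely⁻ {a? = no _} {b? = no _} {c? = yes _} ()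
  classify-lonely⁻ {a? = no ¬a} {b? = no ¬b} {c? = no ¬c} _ = ¬a , ¬b , ¬c

-- Cyclic order on Fin (suc m)

module _ {m : ℕ} where

  -- Opaque, so that conversion checking never unfolds the modular arithmetic.
  opaque
    rotate : ℕ → Fin (suc m) → Fin (suc m)
    rotate d k = (toℕ k + d) mod suc m

    toℕ-rotate : ∀ d k → toℕ (rotate d k) ≡ (toℕ k + d) % suc m
    toℕ-rotate d k = toℕ-fromℕ< _

  rotate-rotate : ∀ a b k → rotate a (rotate b k) ≡ rotate (b + a) k
  rotate-rotate a b k = toℕ-injective (begin
    toℕ (rotate a (rotate b k))          ≡⟨ toℕ-rotate a (rotate b k) ⟩
    (toℕ (rotate b k) + a) % suc m       ≡⟨ cong (λ z → (z + a) % suc m) (toℕ-rotate b k) ⟩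
    ((toℕ k + b) % suc m + a) % suc m    ≡⟨ %-distribˡ-+ ((toℕ k + b) % suc m) a (suc m) ⟩
    ((toℕ k + b) % suc m % suc m + a % suc m) % suc m
                                         ≡⟨ cong (λ z → (z + a % suc m) % suc m) (m%n%n≡m%n (toℕ k + b) (suc m)) ⟩
    ((toℕ k + b) % suc m + a % suc m) % suc m ≡⟨ %-distribˡ-+ (toℕ k + b) a (suc m) ⟨
    (toℕ k + b + a) % suc m              ≡⟨ cong (_% suc m) (+-assoc (toℕ k) b a) ⟩
    (toℕ k + (b + a)) % suc m            ≡⟨ toℕ-rotate (b + a) k ⟨
    toℕ (rotate (b + a) k)               ∎)
    where open ≡-Reasoning

  rotate-period : ∀ k → rotate (suc m) k ≡ k
  rotate-period k = toℕ-injective (begin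
    toℕ (rotate (suc m) k)  ≡⟨ toℕ-rotate (suc m) k ⟩
    (toℕ k + suc m) % suc m ≡⟨ [m+n]%n≡m%n (toℕ k) (suc m) ⟩
    toℕ k % suc m           ≡⟨ m<n⇒m%n≡m (toℕ<n k) ⟩
    toℕ k                   ∎)
    where open ≡-Reasoning

  rotate-zero : ∀ k → rotate 0 k ≡ k
  rotate-zero k = toℕ-injective (trans (toℕ-rotate 0 k) (trans (cong (_% suc m) (+-identityʳ (toℕ k))) (m<n⇒m%n≡m (toℕ<n k))))

  rotate-≢ : ∀ {d} k → 0 < d → d < suc m → rotate d k ≢ k
  rotate-≢ {d} k 0<d d<n rot≡k with toℕ k + d <? suc m
  ... | yes k+d<n = <-irrefl (+-identityʳ (toℕ k)) (≤-trans (+-monoʳ-< (toℕ k) 0<d) (≤-reflexive k+d≡k))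
    where
    k+d≡k : toℕ k + d ≡ toℕ k
    k+d≡k = trans (sym (m<n⇒m%n≡m k+d<n)) (trans (sym (toℕ-rotate d k)) (cong toℕ rot≡k))
  ... | no k+d≮n = <-irrefl (+-cancelˡ-≡ (toℕ k) d (suc m) k+d≡k+n) d<n
    where
    n≤k+d = ≮⇒≥ k+d≮n
    wrapped : toℕ k + d ∸ suc m ≡ toℕ k
    wrapped = begin
      toℕ k + d ∸ suc m            ≡⟨ m<n⇒m%n≡m (m<n+o⇒m∸n<o _ (suc m) (+-mono-< (toℕ<n k) d<n)) ⟨
      (toℕ k + d ∸ suc m) % suc m  ≡⟨ m≤n⇒[n∸m]%m≡n%m n≤k+d ⟩
      (toℕ k + d) % suc m          ≡⟨ toℕ-rotate d k ⟨
      toℕ (rotate d k)             ≡⟨ cong toℕ rot≡k ⟩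
      toℕ k                        ∎
      where open ≡-Reasoning
    k+d≡k+n : toℕ k + d ≡ toℕ k + suc m
    k+d≡k+n = trans (sym (m∸n+n≡m n≤k+d)) (cong (_+ suc m) wrapped)

  rotate-distinct : ∀ {i j} k → i < j → j < suc m → rotate i k ≢ rotate j k
  rotate-distinct {i} {j} k i<j j<n eq =
    rotate-≢ (rotate i k) (m<n⇒0<n∸m i<j) (≤-<-trans (m∸n≤m j i) j<n) (begin
      rotate (j ∸ i) (rotate i k) ≡⟨ rotate-rotate (j ∸ i) i k ⟩
      rotate (i + (j ∸ i)) k      ≡⟨ cong (λ d → rotate d k) (m+[n∸m]≡n (<⇒≤ i<j)) ⟩
      rotate j k                  ≡⟨ eq ⟨
      rotate i k                  ∎)
    where open ≡-Reasoning

  next prev : Fin (suc m) → Fin (suc m)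
  next = rotate 1
  prev = rotate m

  next-prev : ∀ k → next (prev k) ≡ k
  next-prev k = trans (rotate-rotate 1 m k) (trans (cong (λ d → rotate d k) (+-comm m 1)) (rotate-period k))

  prev-next : ∀ k → prev (next k) ≡ k
  prev-next k = trans (rotate-rotate m 1 k) (rotate-period k)

  next-injective : ∀ {k l} → next k ≡ next l → k ≡ l
  next-injective {k} {l} eq = trans (sym (prev-next k)) (trans (cong prev eq) (prev-next l))

  prev-injective : ∀ {k l} → prev k ≡ prev l → k ≡ l
  prev-injective {k} {l} eq = trans (sym (next-prev k)) (trans (cong next eq) (next-prev l))

  toℕ-next : ∀ k → toℕ (next k) ≡ suc (toℕ k) ⊎ (toℕ k ≡ m × toℕ (next k) ≡ 0)
  toℕ-next k with m≤n⇒m<n∨m≡n (s≤s⁻¹ (toℕ<n k))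
  ... | inj₁ k<m = inj₁ (trans (toℕ-rotate 1 k) (trans (cong (_% suc m) (+-comm (toℕ k) 1)) (m<n⇒m%n≡m (s≤s k<m))))
  ... | inj₂ k≡m = inj₂ (k≡m , trans (toℕ-rotate 1 k) (trans (cong (λ z → (z + 1) % suc m) k≡m)
                                 (trans (cong (_% suc m) (+-comm m 1)) (n%n≡0 (suc m)))))

  next-of-suc : ∀ k l → toℕ l ≡ suc (toℕ k) → l ≡ next k
  next-of-suc k l l≡1+k with toℕ-next k
  ... | inj₁ next≡1+k = toℕ-injective (trans l≡1+k (sym next≡1+k))
  ... | inj₂ (k≡m , _) = ⊥-elim (<-irrefl refl (subst (_< suc m) (trans l≡1+k (cong suc k≡m)) (toℕ<n l)))

  next-of-last : ∀ k l → toℕ k ≡ m → toℕ l ≡ 0 → l ≡ next k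
  next-of-last k l k≡m l≡0 with toℕ-next k
  ... | inj₁ next≡1+k = ⊥-elim (<-irrefl refl (subst (_< suc m) (trans next≡1+k (cong suc k≡m)) (toℕ<n (next k))))
  ... | inj₂ (_ , next≡0) = toℕ-injective (trans l≡0 (sym next≡0))

≡ᵇ-refl : ∀ a → (a ≡ᵇ a) ≡ true
≡ᵇ-refl a = to T-≡ (≡⇒≡ᵇ a a refl)

module _ {m : ℕ} where

  rim-adjacent : ∀ (k l : Fin (suc m)) → wheelAdj (suc m) (suc k) (suc l) ≡ true → l ≡ next k ⊎ k ≡ next l
  rim-adjacent k l adj with to T-∨ (from T-≡ adj)
  ... | inj₁ l≡1+k = inj₁ (next-of-suc k l (≡ᵇ⇒≡ _ _ l≡1+k))
  ... | inj₂ adj′ with to T-∨ adj′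
  ...   | inj₁ k≡1+l = inj₂ (next-of-suc l k (≡ᵇ⇒≡ _ _ k≡1+l))
  ...   | inj₂ adj″ with to T-∨ adj″
  ...     | inj₁ wrap = let k≡m , l≡0 = to T-∧ wrap in inj₁ (next-of-last k l (≡ᵇ⇒≡ _ _ k≡m) (≡ᵇ⇒≡ _ _ l≡0))
  ...     | inj₂ wrap = let l≡m , k≡0 = to T-∧ wrap in inj₂ (next-of-last l k (≡ᵇ⇒≡ _ _ l≡m) (≡ᵇ⇒≡ _ _ k≡0))

  next-adjacent : ∀ (k : Fin (suc m)) → wheelAdj (suc m) (suc k) (suc (next k)) ≡ true
  next-adjacent k with toℕ-next k
  ... | inj₁ next≡1+k rewrite next≡1+k | ≡ᵇ-refl (toℕ k) = refl
  ... | inj₂ (k≡m , next≡0) rewrite next≡0 | k≡m | ≡ᵇ-refl m = ∨-zeroʳ (m ≡ᵇ 1)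

  next-adjacentʳ : ∀ (k : Fin (suc m)) → wheelAdj (suc m) (suc (next k)) (suc k) ≡ true
  next-adjacentʳ k with toℕ-next k
  ... | inj₁ next≡1+k rewrite next≡1+k | ≡ᵇ-refl (toℕ k) = ∨-zeroʳ _
  ... | inj₂ (k≡m , next≡0) rewrite next≡0 | k≡m | ≡ᵇ-refl m = trans (cong ((m ≡ᵇ 1) ∨_) (∨-zeroʳ _)) (∨-zeroʳ _)

next≢ : ∀ {m} (k : Fin (2 + m)) → next k ≢ k
next≢ k = rotate-≢ k (s≤s z≤n) (s≤s (s≤s z≤n))

next²≢ : ∀ {m} (k : Fin (3 + m)) → next (next k) ≢ k
next²≢ k = rotate-≢ k (s≤s z≤n) (s≤s (s≤s (s≤s z≤n))) ∘ trans (sym (rotate-rotate 1 1 k))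

next³≢ : ∀ {m} (k : Fin (4 + m)) → next (next (next k)) ≢ k
next³≢ k = rotate-≢ k (s≤s z≤n) (s≤s (s≤s (s≤s (s≤s z≤n))))
         ∘ trans (sym (trans (cong next (rotate-rotate 1 1 k)) (rotate-rotate 1 2 k)))

-- The central graph of a wheel

module CentralWheel (m : ℕ) where

  Rim : Set
  Rim = Fin (3 + m)

  G : Graph
  G = Central (4 + m) (wheelAdj (3 + m))

  Vertex : Set
  Vertex = V G

  infix 4 _~_
  _~_ : Vertex → Vertex → Set
  _~_ = E G

  hub : Vertex
  hub = inj₁ zero

  rim : Rim → Vertex
  rim k = inj₁ (suc k)

  spokeMid : Rim → Vertex
  spokeMid k = inj₂ ((zero , suc k) , s≤s z≤n , refl)

  rimEdge : Rim → EdgeOf (4 + m) (wheelAdj (3 + m))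
  rimEdge k with toℕ k <? toℕ (next k)
  ... | yes k<k⁺ = (suc k , suc (next k)) , s≤s k<k⁺ , next-adjacent k
  ... | no k≮k⁺ = (suc (next k) , suc k) , s≤s (≤∧≢⇒< (≮⇒≥ k≮k⁺) (next≢ k ∘ toℕ-injective)) , next-adjacentʳ k

  rimMid : Rim → Vertex
  rimMid k = inj₂ (rimEdge k)

  rim-injective : ∀ {k l} → rim k ≡ rim l → k ≡ l
  rim-injective refl = refl

  hub≢rim : ∀ {k} → hub ≢ rim k
  hub≢rim ()

  mid≢rim : ∀ {e k} → inj₂ e ≢ rim k
  mid≢rim ()

  mid≢hub : ∀ {e} → inj₂ e ≢ hub
  mid≢hub ()

  mid∉rims : ∀ {e k l} → ¬ (inj₂ e ≡ rim k ⊎ inj₂ e ≡ rim l)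
  mid∉rims (inj₁ ())
  mid∉rims (inj₂ ())

  ~mid-sym : ∀ {u e} → inj₁ u ~ inj₂ e → inj₂ e ~ inj₁ u
  ~mid-sym {e = (_ , _) , _} adj = adj

  rimMid-neighbours : ∀ k w → rimMid k ~ w → w ≡ rim k ⊎ w ≡ rim (next k)
  rimMid-neighbours k (inj₁ u) adj with toℕ k <? toℕ (next k) | adj
  ... | yes _ | inj₁ refl = inj₁ refl
  ... | yes _ | inj₂ refl = inj₂ refl
  ... | no _  | inj₁ refl = inj₂ refl
  ... | no _  | inj₂ refl = inj₁ refl

  rim~rimMid : ∀ k → rim k ~ rimMid k
  rim~rimMid k with toℕ k <? toℕ (next k)
  ... | yes _ = inj₁ refl
  ... | no _ = inj₂ refl

  spokeMid-neighbours : ∀ k w → spokeMid k ~ w → w ≡ hub ⊎ w ≡ rim k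
  spokeMid-neighbours k (inj₁ u) (inj₁ refl) = inj₁ refl
  spokeMid-neighbours k (inj₁ u) (inj₂ refl) = inj₂ refl

  hub≁hub : ¬ hub ~ hub
  hub≁hub (0≢0 , _) = 0≢0 refl

  hub≁rim : ∀ k → ¬ hub ~ rim k
  hub≁rim k (_ , ())

  hub≁rimMid : ∀ k → ¬ hub ~ rimMid k
  hub≁rimMid k adj with rimMid-neighbours k hub adj
  ... | inj₁ ()
  ... | inj₂ ()

  rim~rim : ∀ {k l} → k ≢ l → l ≢ next k → k ≢ next l → rim k ~ rim l
  rim~rim {k} {l} k≢l l≢k⁺ k≢l⁺ = k≢l ∘ suc-injective , nonadjacent
    where
    nonadjacent : wheelAdj (3 + m) (suc k) (suc l) ≡ false
    nonadjacent with wheelAdj (3 + m) (suc k) (suc l) in adj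
    ... | false = refl
    ... | true with rim-adjacent k l adj
    ...   | inj₁ l≡k⁺ = ⊥-elim (l≢k⁺ l≡k⁺)
    ...   | inj₂ k≡l⁺ = ⊥-elim (k≢l⁺ k≡l⁺)

  module TDC {j} (c : Vertex → Fin j) (tdc : IsTDC G j c) where

    proper : ∀ {u w} → u ~ w → c u ≢ c w
    proper = proj₁ tdc _ _

    target : Vertex → Fin j
    target u = proj₁ (proj₂ tdc u)

    target-class : ∀ {u} w → c w ≡ target u → u ~ w
    target-class {u} = proj₂ (proj₂ (proj₂ tdc u))

    target-within : ∀ {u a b} → (∀ w → u ~ w → w ≡ a ⊎ w ≡ b) → target u ≡ c a ⊎ target u ≡ c b
    target-within {u} nbrs with proj₁ (proj₂ (proj₂ tdc u))
    ... | w , cw≡ with nbrs w (target-class w cw≡)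
    ...   | inj₁ refl = inj₁ (sym cw≡)
    ...   | inj₂ refl = inj₂ (sym cw≡)

    hub≢target-hub : c hub ≢ target hub
    hub≢target-hub = hub≁hub ∘ target-class hub

    rim≢target-hub : ∀ k → c (rim k) ≢ target hub
    rim≢target-hub k = hub≁rim k ∘ target-class (rim k)

    rimMid≢target-hub : ∀ k → c (rimMid k) ≢ target hub
    rimMid≢target-hub k = hub≁rimMid k ∘ target-class (rimMid k)

    rim-same-colour : ∀ k l → c (rim k) ≡ c (rim l) → k ≡ l ⊎ l ≡ next k ⊎ k ≡ next l
    rim-same-colour k l same with k ≟ l | l ≟ next k | k ≟ next l
    ... | yes k≡l | _ | _ = inj₁ k≡l
    ... | no _ | yes l≡k⁺ | _ = inj₂ (inj₁ l≡k⁺)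
    ... | no _ | no _ | yes k≡l⁺ = inj₂ (inj₂ k≡l⁺)
    ... | no k≢l | no l≢k⁺ | no k≢l⁺ = ⊥-elim (proper (rim~rim k≢l l≢k⁺ k≢l⁺) same)

    spoke-class : ∀ k w → c w ≡ target (spokeMid k) → w ≡ hub ⊎ w ≡ rim k
    spoke-class k w = spokeMid-neighbours k w ∘ target-class w

    spoke-target : ∀ k → target (spokeMid k) ≡ c hub ⊎ target (spokeMid k) ≡ c (rim k)
    spoke-target k = target-within (spokeMid-neighbours k)

    arc-class : ∀ k w → c w ≡ target (rimMid k) → w ≡ rim k ⊎ w ≡ rim (next k)
    arc-class k w = rimMid-neighbours k w ∘ target-class w

    arc-target : ∀ k → target (rimMid k) ≡ c (rim k) ⊎ target (rimMid k) ≡ c (rim (next k))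
    arc-target k = target-within (rimMid-neighbours k)

    pair-class : ∀ k → c (rim k) ≡ c (rim (next k)) → ∀ w → c w ≡ c (rim k) → w ≡ rim k ⊎ w ≡ rim (next k)
    pair-class k same w cw with arc-target k
    ... | inj₁ b≡cv = arc-class k w (trans cw (sym b≡cv))
    ... | inj₂ b≡cv⁺ = arc-class k w (trans cw (trans same (sym b≡cv⁺)))

    pair⇒next-arc-target : ∀ k → c (rim k) ≡ c (rim (next k)) → target (rimMid (next k)) ≡ c (rim (next (next k)))
    pair⇒next-arc-target k same with arc-target (next k)
    ... | inj₂ b⁺≡cv⁺⁺ = b⁺≡cv⁺⁺
    ... | inj₁ b⁺≡cv⁺ with arc-class (next k) (rim k) (trans same (sym b⁺≡cv⁺))
    ...   | inj₁ k≡k⁺ = ⊥-elim (next≢ k (sym (rim-injective k≡k⁺)))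
    ...   | inj₂ k≡k⁺⁺ = ⊥-elim (next²≢ k (sym (rim-injective k≡k⁺⁺)))

    shared-rim-colour⇒spoke-to-hub : ∀ {k l} → l ≢ k → c (rim l) ≡ c (rim k) → target (spokeMid k) ≡ c hub
    shared-rim-colour⇒spoke-to-hub {k} {l} l≢k same with spoke-target k
    ... | inj₁ a≡t = a≡t
    ... | inj₂ a≡cv with spoke-class k (rim l) (trans same (sym a≡cv))
    ...   | inj₂ l≡k = ⊥-elim (l≢k (rim-injective l≡k))

    two-spokes-to-hub⇒hub-alone : ∀ {k l} → k ≢ l → target (spokeMid k) ≡ c hub → target (spokeMid l) ≡ c hub →
                                  ∀ w → c w ≡ c hub → w ≡ hub
    two-spokes-to-hub⇒hub-alone {k} {l} k≢l ak al w cw with spoke-class k w (trans cw (sym ak))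
    ... | inj₁ w≡hub = w≡hub
    ... | inj₂ refl with spoke-class l (rim k) (trans cw (sym al))
    ...   | inj₂ k≡l = ⊥-elim (k≢l (rim-injective k≡l))

    no-two-rims-share-hub-target : ∀ {k l} → k ≢ l → target (rim k) ≡ target hub → target (rim l) ≡ target hub → ⊥
    no-two-rims-share-hub-target {k} {l} k≢l yk≡x yl≡x with proj₁ (proj₂ (proj₂ tdc hub))
    ... | w , cw = no-common-neighbour w (target-class w cw) (target-class w (trans cw (sym yk≡x))) (target-class w (trans cw (sym yl≡x)))
      where
      no-common-neighbour : ∀ w → hub ~ w → rim k ~ w → rim l ~ w → ⊥
      no-common-neighbour (inj₁ zero) hub~w _ _ = hub≁hub hub~w
      no-common-neighbour (inj₁ (suc u)) hub~w _ _ = hub≁rim u hub~w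
      no-common-neighbour (inj₂ _) (inj₁ refl) (inj₁ ()) _
      no-common-neighbour (inj₂ _) (inj₁ refl) (inj₂ refl) (inj₁ ())
      no-common-neighbour (inj₂ _) (inj₁ refl) (inj₂ refl) (inj₂ l≡k) = k≢l (sym (suc-injective l≡k))
      no-common-neighbour (inj₂ _) (inj₂ refl) (inj₂ ()) _
      no-common-neighbour (inj₂ _) (inj₂ refl) (inj₁ refl) (inj₂ ())
      no-common-neighbour (inj₂ _) (inj₂ refl) (inj₁ refl) (inj₁ l≡k) = k≢l (sym (suc-injective l≡k))

  record RimColouring (R : ℕ) : Set where
    field
      colour : Rim → Fin R
      same-colour⇒consecutive : ∀ k l → colour k ≡ colour l → k ≡ l ⊎ l ≡ next k ⊎ k ≡ next l
      arc-class : ∀ k → ∃ λ d → ∀ l → colour l ≡ colour d → l ≡ k ⊎ l ≡ next k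
      far-class : ∀ k → ∃ λ d → ∀ l → colour l ≡ colour d → k ≢ l × l ≢ next k × k ≢ next l

  module _ {R} (rc : RimColouring R) where

    open RimColouring rc

    extend : Vertex → Fin (3 + R)
    extend (inj₁ zero) = zero
    extend (inj₁ (suc k)) = suc (suc (suc (colour k)))
    extend (inj₂ ((zero , _) , _)) = suc zero
    extend (inj₂ ((suc _ , _) , _)) = suc (suc zero)

    shift₃-injective : ∀ {a b : Fin R} → _≡_ {A = Fin (3 + R)} (suc (suc (suc a))) (suc (suc (suc b))) → a ≡ b
    shift₃-injective refl = refl

    extend-proper : ∀ u w → u ~ w → extend u ≢ extend w
    extend-proper (inj₁ zero) (inj₁ zero) (0≢0 , _) _ = 0≢0 refl
    extend-proper (inj₁ (suc k)) (inj₁ (suc l)) (k≢l , nonadjacent) same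
      with same-colour⇒consecutive k l (shift₃-injective same)
    ... | inj₁ refl = k≢l refl
    ... | inj₂ (inj₁ refl) with trans (sym (next-adjacent k)) nonadjacent
    ...   | ()
    extend-proper (inj₁ (suc k)) (inj₁ (suc l)) (k≢l , nonadjacent) same | inj₂ (inj₂ refl)
      with trans (sym (next-adjacentʳ l)) nonadjacent
    ...   | ()
    extend-proper (inj₁ zero) (inj₂ ((zero , _) , _)) _ ()
    extend-proper (inj₁ zero) (inj₂ ((suc _ , _) , _)) _ ()
    extend-proper (inj₁ (suc k)) (inj₂ ((zero , _) , _)) _ ()
    extend-proper (inj₁ (suc k)) (inj₂ ((suc _ , _) , _)) _ ()
    extend-proper (inj₂ ((zero , _) , _)) (inj₁ zero) _ ()
    extend-proper (inj₂ ((suc _ , _) , _)) (inj₁ zero) _ ()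
    extend-proper (inj₂ ((zero , _) , _)) (inj₁ (suc k)) _ ()
    extend-proper (inj₂ ((suc _ , _) , _)) (inj₁ (suc k)) _ ()

    Dominates : Vertex → Fin (3 + R) → Set
    Dominates u i = (∃ λ w → extend w ≡ i) × (∀ w → extend w ≡ i → u ~ w)

    rim-class-dominated : ∀ {u} d → (∀ l → colour l ≡ colour d → u ~ rim l) → Dominates u (suc (suc (suc (colour d))))
    rim-class-dominated {u} d near = (rim d , refl) , within
      where
      within : ∀ w → extend w ≡ suc (suc (suc (colour d))) → u ~ w
      within (inj₁ (suc l)) same = near l (shift₃-injective same)
      within (inj₁ zero) ()
      within (inj₂ ((zero , _) , _)) ()
      within (inj₂ ((suc _ , _) , _)) ()

    extend-dominating : ∀ u → ∃ (Dominates u)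
    extend-dominating (inj₁ zero) = suc zero , (spokeMid zero , refl) , spokes
      where
      spokes : ∀ w → extend w ≡ suc zero → hub ~ w
      spokes (inj₂ ((zero , _) , _)) _ = inj₁ refl
      spokes (inj₂ ((suc _ , _) , _)) ()
      spokes (inj₁ zero) ()
      spokes (inj₁ (suc _)) ()
    extend-dominating (inj₁ (suc i)) = _ , rim-class-dominated d far
      where
      d = proj₁ (far-class i)
      far : ∀ l → colour l ≡ colour d → rim i ~ rim l
      far l same = let i≢l , l≢i⁺ , i≢l⁺ = proj₂ (far-class i) l same in rim~rim i≢l l≢i⁺ i≢l⁺
    extend-dominating (inj₂ ((zero , b) , _)) = zero , (hub , refl) , hub-only
      where
      hub-only : ∀ w → extend w ≡ zero → inj₂ ((zero , b) , _) ~ w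
      hub-only (inj₁ zero) _ = inj₁ refl
      hub-only (inj₁ (suc _)) ()
      hub-only (inj₂ ((zero , _) , _)) ()
      hub-only (inj₂ ((suc _ , _) , _)) ()
    extend-dominating (inj₂ ((suc a , suc b) , a<b , adj)) with rim-adjacent a b adj
    ... | inj₁ refl = _ , rim-class-dominated d ends
      where
      d = proj₁ (arc-class a)
      ends : ∀ l → colour l ≡ colour d → inj₂ ((suc a , suc (next a)) , a<b , adj) ~ rim l
      ends l same with proj₂ (arc-class a) l same
      ... | inj₁ refl = inj₁ refl
      ... | inj₂ refl = inj₂ refl
    ... | inj₂ refl = _ , rim-class-dominated d ends
      where
      d = proj₁ (arc-class b)
      ends : ∀ l → colour l ≡ colour d → inj₂ ((suc (next b) , suc b) , a<b , adj) ~ rim l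
      ends l same with proj₂ (arc-class b) l same
      ... | inj₁ refl = inj₂ refl
      ... | inj₂ refl = inj₁ refl

    rimColouring⇒TDC : HasTDC G (3 + R)
    rimColouring⇒TDC = extend , extend-proper , extend-dominating

-- Rims of at least four vertices: 2n + 9 ≤ 3 χ

module LowerBound (q : ℕ) where

  open CentralWheel (suc q)

  n : ℕ
  n = 4 + q

  module _ {j} (c : Vertex → Fin j) (tdc : IsTDC G j c) where

    open TDC c tdc

    t x : Fin j
    t = c hub
    x = target hub

    cv : Rim → Fin j
    cv k = c (rim k)

    t≢x : t ≢ x
    t≢x = hub≢target-hub

    cv≢x : ∀ k → cv k ≢ x
    cv≢x = rim≢target-hub

    b : Rim → Fin j
    b k = target (rimMid k)

    injective-rim-colours : ∀ z → z ≢ x → (∀ k → cv k ≢ z) → (∀ k l → cv k ≡ cv l → k ≡ l) → n + 2 ≤ j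
    injective-rim-colours z z≢x cv≢z inj = subst (λ k → k + 2 ≤ j) (count-true n) $
      count-≤-avoiding (λ _ → true) cv ((z≢x ∷ []) ∷ [] ∷ []) (λ {k} _ → cv≢z k ∷ cv≢x k ∷ []) (λ _ _ → inj _ _)

    rim-singleton : ∀ k → target (spokeMid k) ≢ t → ∀ w → c w ≡ cv k → w ≡ rim k
    rim-singleton k a≢t w cw with spoke-target k
    ... | inj₁ a≡t = ⊥-elim (a≢t a≡t)
    ... | inj₂ a≡cv with spoke-class k w (trans cw (sym a≡cv))
    ...   | inj₁ refl = ⊥-elim (a≢t (trans a≡cv (sym cw)))
    ...   | inj₂ w≡rim = w≡rim

    spokes-avoid-hub-colour : (∀ k → target (spokeMid k) ≢ t) → n + 2 ≤ j
    spokes-avoid-hub-colour a≢t = injective-rim-colours t t≢x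
      (λ k cv≡t → hub≢rim (rim-singleton k (a≢t k) hub (sym cv≡t)))
      (λ k l same → rim-injective (sym (rim-singleton k (a≢t k) (rim l) (sym same))))

    hub-and-rim-in-spoke-target : ∀ i → target (spokeMid i) ≡ t → cv i ≡ t → n + 2 ≤ j
    hub-and-rim-in-spoke-target i a≡t cv≡t = injective-rim-colours (c (rimMid i)) (rimMid≢target-hub i) cv≢z inj
      where
      t-class : ∀ w → c w ≡ t → w ≡ hub ⊎ w ≡ rim i
      t-class w cw = spoke-class i w (trans cw (sym a≡t))
      a≢t : ∀ k → k ≢ i → target (spokeMid k) ≢ t
      a≢t k k≢i ak≡t with spoke-class k (rim i) (trans cv≡t (sym ak≡t))
      ... | inj₂ same = k≢i (sym (rim-injective same))
      cv≢z : ∀ k → cv k ≢ c (rimMid i)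
      cv≢z k cv≡z with k ≟ i
      ... | no k≢i = mid≢rim (rim-singleton k (a≢t k k≢i) (rimMid i) (sym cv≡z))
      ... | yes refl with t-class (rimMid i) (trans (sym cv≡z) cv≡t)
      ...   | inj₁ ()
      ...   | inj₂ ()
      inj : ∀ k l → cv k ≡ cv l → k ≡ l
      inj k l same with k ≟ i | l ≟ i
      ... | no k≢i | _ = sym (rim-injective (rim-singleton k (a≢t k k≢i) (rim l) (sym same)))
      ... | yes _ | no l≢i = rim-injective (rim-singleton l (a≢t l l≢i) (rim k) same)
      ... | yes k≡i | yes l≡i = trans k≡i (sym l≡i)

    module HubAlone (alone : ∀ w → c w ≡ t → w ≡ hub) where

      kind : Rim → Kind
      kind k = classify (cv k ≟ cv (next k)) (cv (prev k) ≟ cv k) (b k ≟ cv k ⊎-dec b (prev k) ≟ cv k)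

      no-triple : ∀ k → cv k ≡ cv (next k) → cv (next k) ≢ cv (next (next k))
      no-triple k e₁ e₂ with rim-same-colour k (next (next k)) (trans e₁ e₂)
      ... | inj₁ k≡k⁺⁺ = next²≢ k (sym k≡k⁺⁺)
      ... | inj₂ (inj₁ k⁺⁺≡k⁺) = next≢ (next k) k⁺⁺≡k⁺
      ... | inj₂ (inj₂ k≡k⁺⁺⁺) = next³≢ k (sym k≡k⁺⁺⁺)

      pairEnd⇒pairStart : ∀ k → T (is pairEnd (kind k)) → T (is pairStart (kind (prev k)))
      pairEnd⇒pairStart k e = classify-pairStart (trans (classify-pairEnd⁻ e) (cong cv (sym (next-prev k))))

      pairStart⇒dominated : ∀ k → T (is pairStart (kind k)) → T (is dominated (kind (next (next k))))
      pairStart⇒dominated k start =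
        classify-dominated k⁺⁺-not-start k⁺⁺-not-end (inj₂ (trans (cong b (prev-next k⁺)) b⁺≡cv⁺⁺))
        where
        k⁺ = next k
        k⁺⁺ = next k⁺
        pair : cv k ≡ cv k⁺
        pair = classify-pairStart⁻ start
        b⁺≡cv⁺⁺ : b k⁺ ≡ cv k⁺⁺
        b⁺≡cv⁺⁺ = pair⇒next-arc-target k pair
        k⁺⁺-not-start : cv k⁺⁺ ≢ cv (next k⁺⁺)
        k⁺⁺-not-start same with arc-class k⁺ (rim (next k⁺⁺)) (trans (sym same) (sym b⁺≡cv⁺⁺))
        ... | inj₁ k⁺⁺⁺≡k⁺ = next²≢ k⁺ (rim-injective k⁺⁺⁺≡k⁺)
        ... | inj₂ k⁺⁺⁺≡k⁺⁺ = next≢ k⁺⁺ (rim-injective k⁺⁺⁺≡k⁺⁺)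
        k⁺⁺-not-end : cv (prev k⁺⁺) ≢ cv k⁺⁺
        k⁺⁺-not-end = no-triple k pair ∘ trans (cong cv (sym (prev-next k⁺)))

      lonely⇒dominated : ∀ k → T (is lonely (kind k)) → T (is dominated (kind (next k)))
      lonely⇒dominated k alone-k =
        classify-dominated k⁺-not-start (not-start ∘ trans (cong cv (sym (prev-next k)))) (inj₂ (trans (cong b (prev-next k)) b≡cv⁺))
        where
        k⁺ = next k
        facts = classify-lonely⁻ alone-k
        not-start = proj₁ facts
        b≡cv⁺ : b k ≡ cv k⁺
        b≡cv⁺ with arc-target k
        ... | inj₁ b≡cv = ⊥-elim (proj₂ (proj₂ facts) (inj₁ b≡cv))
        ... | inj₂ b≡cv⁺ = b≡cv⁺
        k⁺-not-start : cv k⁺ ≢ cv (next k⁺)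
        k⁺-not-start same with arc-class k (rim (next k⁺)) (trans (sym same) (sym b≡cv⁺))
        ... | inj₁ k⁺⁺≡k = next²≢ k (rim-injective k⁺⁺≡k)
        ... | inj₂ k⁺⁺≡k⁺ = next≢ k⁺ (rim-injective k⁺⁺≡k⁺)

      not-pairEnd : Rim → Bool
      not-pairEnd k = not (is pairEnd (kind k))

      pair-second-is-pairEnd : ∀ k → cv k ≡ cv (next k) → ¬ T (not-pairEnd (next k))
      pair-second-is-pairEnd k pair ok with classify-not-pairEnd⁻ ok
      ... | inj₁ start = no-triple k pair start
      ... | inj₂ not-end = not-end (trans (cong cv (prev-next k)) pair)

      rim-colour-injective : ∀ {k l} → T (not-pairEnd k) → T (not-pairEnd l) → cv k ≡ cv l → k ≡ l
      rim-colour-injective {k} {l} k-ok l-ok same with rim-same-colour k l same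
      ... | inj₁ k≡l = k≡l
      ... | inj₂ (inj₁ refl) = ⊥-elim (pair-second-is-pairEnd k same l-ok)
      ... | inj₂ (inj₂ refl) = ⊥-elim (pair-second-is-pairEnd l (sym same) k-ok)

      shares-rim-colour⇒lonely : ∀ e l → c (inj₂ e) ≡ cv l → T (is lonely (kind l))
      shares-rim-colour⇒lonely e l ce = classify-lonely not-start not-end not-dominated
        where
        not-start : cv l ≢ cv (next l)
        not-start pair = mid∉rims (pair-class l pair (inj₂ e) ce)
        not-end : cv (prev l) ≢ cv l
        not-end pair = mid∉rims (pair-class (prev l) (trans pair (cong cv (sym (next-prev l)))) (inj₂ e) (trans ce (sym pair)))
        not-dominated : ¬ (b l ≡ cv l ⊎ b (prev l) ≡ cv l)
        not-dominated (inj₁ b≡cv) = mid∉rims (arc-class l (inj₂ e) (trans ce (sym b≡cv)))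
        not-dominated (inj₂ b⁻≡cv) = mid∉rims (arc-class (prev l) (inj₂ e) (trans ce (sym b⁻≡cv)))

      pairEnd≤pairStart : tally pairEnd kind ≤ tally pairStart kind
      pairEnd≤pairStart = count-injective-≤ (λ k → is pairEnd (kind k)) (λ k → is pairStart (kind k)) prev
                            (pairEnd⇒pairStart _) (λ _ _ → prev-injective)

      start-or-lonely : Rim → Bool
      start-or-lonely k = is pairStart (kind k) ∨ is lonely (kind k)

      jump : Rim → Rim
      jump k = if is pairStart (kind k) then next (next k) else next k

      jump-dominated : ∀ k → T (start-or-lonely k) → T (is dominated (kind (jump k)))
      jump-dominated k ok with is pairStart (kind k) in start
      ... | true = pairStart⇒dominated k (from T-≡ start)
      ... | false = lonely⇒dominated k ok

      start-then-lonely : ∀ k l → T (is pairStart (kind k)) → T (is lonely (kind l)) → next k ≢ l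
      start-then-lonely k l start l-lonely refl =
        proj₁ (proj₂ (classify-lonely⁻ l-lonely)) (trans (cong cv (prev-next k)) (classify-pairStart⁻ start))

      jump-injective : ∀ {k l} → T (start-or-lonely k) → T (start-or-lonely l) → jump k ≡ jump l → k ≡ l
      jump-injective {k} {l} k-ok l-ok eq with is pairStart (kind k) in sk | is pairStart (kind l) in sl
      ... | true  | true  = next-injective (next-injective eq)
      ... | false | false = next-injective eq
      ... | true  | false = ⊥-elim (start-then-lonely k l (from T-≡ sk) l-ok (next-injective eq))
      ... | false | true  = ⊥-elim (start-then-lonely l k (from T-≡ sl) k-ok (next-injective (sym eq)))

      start+lonely≤dominated : tally pairStart kind + tally lonely kind ≤ tally dominated kind
      start+lonely≤dominated = subst (_≤ tally dominated kind) (tally-start-or-lonely kind)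
        (count-injective-≤ start-or-lonely (λ k → is dominated (kind k)) jump (jump-dominated _) jump-injective)

      colour-budget : 2 * n + 2 * tally lonely kind ≤ 3 * count not-pairEnd
      colour-budget = subst₂ (λ N D → 2 * N + 2 * tally lonely kind ≤ 3 * D)
        (sym (tally-partition kind)) (sym (tally-not-pairEnd kind))
        (2[a+b+c+d]+2d≤3[a+c+d] (tally pairStart kind) (tally pairEnd kind) (tally dominated kind) (tally lonely kind)
                      pairEnd≤pairStart start+lonely≤dominated)

      cv≢t : ∀ k → cv k ≢ t
      cv≢t k = hub≢rim ∘ sym ∘ alone (rim k)

      fresh-arc-colour : ∀ k → (∀ l → c (rimMid k) ≢ cv l) → 2 * n + 9 ≤ 3 * j
      fresh-arc-colour k fresh = begin
        2 * n + 9                                      ≤⟨ +-monoˡ-≤ 9 (m≤m+n (2 * n) _) ⟩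
        2 * n + 2 * tally lonely kind + 9              ≤⟨ +-monoˡ-≤ 9 colour-budget ⟩
        3 * count not-pairEnd + 9                      ≡⟨ *-distribˡ-+ 3 (count not-pairEnd) 3 ⟨
        3 * (count not-pairEnd + 3)                    ≤⟨ *-monoʳ-≤ 3 D+3≤j ⟩
        3 * j                                          ∎
        where
        open ≤-Reasoning
        t≢z : t ≢ c (rimMid k)
        t≢z t≡z = mid≢hub (alone (rimMid k) (sym t≡z))
        D+3≤j : count not-pairEnd + 3 ≤ j
        D+3≤j = count-≤-avoiding not-pairEnd cv ((t≢x ∷ t≢z ∷ []) ∷ ((rimMid≢target-hub k ∘ sym) ∷ []) ∷ [] ∷ [])
                  (λ {l} _ → cv≢t l ∷ cv≢x l ∷ (fresh l ∘ sym) ∷ []) rim-colour-injective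

      every-arc-colour-shared : (∀ k → ∃ λ l → c (rimMid k) ≡ cv l) → 2 * n + 9 ≤ 3 * j
      every-arc-colour-shared shared = begin
        2 * n + 9                                      ≤⟨ +-monoʳ-≤ (2 * n)
                                                       (≤-trans (n≤1+n 9) (+-monoˡ-≤ 6 (*-monoʳ-≤ 2 two≤lonely))) ⟩
        2 * n + (2 * tally lonely kind + 6)            ≡⟨ +-assoc (2 * n) _ 6 ⟨
        2 * n + 2 * tally lonely kind + 6              ≤⟨ +-monoˡ-≤ 6 colour-budget ⟩
        3 * count not-pairEnd + 6                      ≡⟨ *-distribˡ-+ 3 (count not-pairEnd) 2 ⟨
        3 * (count not-pairEnd + 2)                    ≤⟨ *-monoʳ-≤ 3 D+2≤j ⟩
        3 * j                                          ∎
        where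
        open ≤-Reasoning
        l₀ = proj₁ (shared zero)
        l₁ = proj₁ (shared l₀)
        l₁≢l₀ : l₁ ≢ l₀
        l₁≢l₀ l₁≡l₀ = proper (rim~rimMid l₀) (sym (trans (proj₂ (shared l₀)) (cong cv l₁≡l₀)))
        two≤lonely : 2 ≤ tally lonely kind
        two≤lonely = two≤count (λ k → is lonely (kind k))
          (shares-rim-colour⇒lonely _ l₀ (proj₂ (shared zero))) (shares-rim-colour⇒lonely _ l₁ (proj₂ (shared l₀))) l₁≢l₀
        D+2≤j : count not-pairEnd + 2 ≤ j
        D+2≤j = count-≤-avoiding not-pairEnd cv ((t≢x ∷ []) ∷ [] ∷ [])
                  (λ {l} _ → cv≢t l ∷ cv≢x l ∷ []) rim-colour-injective

      lower-bound : 2 * n + 9 ≤ 3 * j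
      lower-bound with all? (λ k → any? (λ l → c (rimMid k) ≟ cv l))
      ... | yes shared = every-arc-colour-shared shared
      ... | no ¬shared with ¬∀⟶∃¬ _ _ (λ k → any? (λ l → c (rimMid k) ≟ cv l)) ¬shared
      ...   | k , ¬∃ = fresh-arc-colour k (λ l same → ¬∃ (l , same))

    from-distinct-rim : n + 2 ≤ j → 2 * n + 9 ≤ 3 * j
    from-distinct-rim n+2≤j = ≤-trans (2n+9≤3[n+2] {n} (s≤s (s≤s (s≤s z≤n)))) (*-monoʳ-≤ 3 n+2≤j)

    lower-bound : 2 * n + 9 ≤ 3 * j
    lower-bound with any? (λ k → target (spokeMid k) ≟ t)
    ... | no ¬any = from-distinct-rim (spokes-avoid-hub-colour (λ k a≡t → ¬any (k , a≡t)))
    ... | yes (i , a≡t) with cv i ≟ t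
    ...   | yes cv≡t = from-distinct-rim (hub-and-rim-in-spoke-target i a≡t cv≡t)
    ...   | no cv≢t = HubAlone.lower-bound alone
      where
      alone : ∀ w → c w ≡ t → w ≡ hub
      alone w cw with spoke-class i w (trans cw (sym a≡t))
      ... | inj₁ w≡hub = w≡hub
      ... | inj₂ refl = ⊥-elim (cv≢t cw)

-- The wheel W₃

opaque
  unfolding rotate

  rim₃-cases : ∀ (k u : Fin 3) → u ≡ k ⊎ u ≡ next k ⊎ u ≡ next (next k)
  rim₃-cases zero zero = inj₁ refl
  rim₃-cases zero (suc zero) = inj₂ (inj₁ refl)
  rim₃-cases zero (suc (suc zero)) = inj₂ (inj₂ refl)
  rim₃-cases (suc zero) zero = inj₂ (inj₂ refl)
  rim₃-cases (suc zero) (suc zero) = inj₁ refl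
  rim₃-cases (suc zero) (suc (suc zero)) = inj₂ (inj₁ refl)
  rim₃-cases (suc (suc zero)) zero = inj₂ (inj₁ refl)
  rim₃-cases (suc (suc zero)) (suc zero) = inj₂ (inj₂ refl)
  rim₃-cases (suc (suc zero)) (suc (suc zero)) = inj₁ refl

  rim₃-next³ : ∀ (k : Fin 3) → next (next (next k)) ≡ k
  rim₃-next³ zero = refl
  rim₃-next³ (suc zero) = refl
  rim₃-next³ (suc (suc zero)) = refl

wheel₃-complete : ∀ a b → wheelAdj 3 a b ≡ false → a ≡ b
wheel₃-complete = toWitness {a? = all? λ a → all? λ b → (wheelAdj 3 a b Bool.≟ false) →-dec (a ≟ b)} _

module TriangleLowerBound where

  open CentralWheel 0

  originals-independent : ∀ u w → ¬ inj₁ u ~ inj₁ w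
  originals-independent u w (u≢w , nonadjacent) = u≢w (wheel₃-complete u w nonadjacent)

  consecutive₃ : ∀ {k l : Rim} → k ≢ l → l ≡ next k ⊎ k ≡ next l
  consecutive₃ {k} {l} k≢l with rim₃-cases k l
  ... | inj₁ l≡k = ⊥-elim (k≢l (sym l≡k))
  ... | inj₂ (inj₁ l≡k⁺) = inj₁ l≡k⁺
  ... | inj₂ (inj₂ refl) = inj₂ (sym (rim₃-next³ k))

  module _ {j} (c : Vertex → Fin j) (tdc : IsTDC G j c) where

    open TDC c tdc

    t x : Fin j
    t = c hub
    x = target hub

    cv : Rim → Fin j
    cv k = c (rim k)

    Original NonOriginal : Fin j → Set
    Original z = ∃ λ u → c (inj₁ u) ≡ z
    NonOriginal z = ∀ u → c (inj₁ u) ≢ z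

    target-nonOriginal : ∀ u → NonOriginal (target (inj₁ u))
    target-nonOriginal u w cw = originals-independent u w (target-class (inj₁ w) cw)

    colours-≤ : ∀ {xs ys} → AllPairs _≢_ xs → All Original xs → AllPairs _≢_ ys → All NonOriginal ys →
                length xs + length ys ≤ j
    colours-≤ {xs} {ys} distinct-xs original distinct-ys non-original =
      subst (_≤ j) (length-++ xs) (length-distinct-≤ (++⁺ distinct-xs distinct-ys (All.map apart original)))
      where
      apart : ∀ {z} → Original z → All (z ≢_) ys
      apart (u , cu≡z) = All.map (λ y-non z≡y → y-non u (trans cu≡z z≡y)) non-original

    record ThreeOriginalColours : Set where
      field
        u₁ u₂ u₃ : Fin 4
        distinct : AllPairs _≢_ (c (inj₁ u₁) ∷ c (inj₁ u₂) ∷ c (inj₁ u₃) ∷ [])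

    NoMidHasOriginalColour : Set
    NoMidHasOriginalColour = ∀ e u → c (inj₂ e) ≢ c (inj₁ u)

    no-pair⇒rims-distinct : (∀ k → cv k ≢ cv (next k)) → ∀ {k l} → k ≢ l → cv k ≢ cv l
    no-pair⇒rims-distinct no-pair k≢l same with consecutive₃ k≢l
    ... | inj₁ refl = no-pair _ same
    ... | inj₂ refl = no-pair _ (sym same)

    module Pair (k : Rim) (pair : cv k ≡ cv (next k)) where

      hub-alone : ∀ w → c w ≡ t → w ≡ hub
      hub-alone = two-spokes-to-hub⇒hub-alone (next≢ k ∘ sym)
        (shared-rim-colour⇒spoke-to-hub (next≢ k) (sym pair)) (shared-rim-colour⇒spoke-to-hub (next≢ k ∘ sym) pair)

      no-mid-has-original-colour : NoMidHasOriginalColour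
      no-mid-has-original-colour e zero ce = mid≢hub (hub-alone (inj₂ e) ce)
      no-mid-has-original-colour e (suc u) ce with rim₃-cases k u
      ... | inj₁ refl = mid∉rims (pair-class k pair (inj₂ e) ce)
      ... | inj₂ (inj₁ refl) = mid∉rims (pair-class k pair (inj₂ e) (trans ce (sym pair)))
      ... | inj₂ (inj₂ refl) = mid∉rims (arc-class (next k) (inj₂ e) (trans ce (sym (pair⇒next-arc-target k pair))))

      three-original-colours : ThreeOriginalColours
      three-original-colours = record
        { u₁ = zero ; u₂ = suc k ; u₃ = suc (next (next k))
        ; distinct = (t≢rim k ∷ t≢rim (next (next k)) ∷ []) ∷ (cv≢cv⁺⁺ ∷ []) ∷ [] ∷ [] }
        where
        t≢rim : ∀ l → t ≢ cv l
        t≢rim l t≡cv = hub≢rim (sym (hub-alone (rim l) (sym t≡cv)))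
        cv≢cv⁺⁺ : cv k ≢ cv (next (next k))
        cv≢cv⁺⁺ same with pair-class k pair (rim (next (next k))) (sym same)
        ... | inj₁ k⁺⁺≡k = next²≢ k (rim-injective k⁺⁺≡k)
        ... | inj₂ k⁺⁺≡k⁺ = next≢ (next k) (rim-injective k⁺⁺≡k⁺)

    module HubShares (i : Rim) (t≡cv : t ≡ cv i) (no-pair : ∀ k → cv k ≢ cv (next k)) where

      spoke-to-hub : target (spokeMid i) ≡ t
      spoke-to-hub with spoke-target i
      ... | inj₁ a≡t = a≡t
      ... | inj₂ a≡cv = trans a≡cv (sym t≡cv)

      t-class : ∀ w → c w ≡ t → w ≡ hub ⊎ w ≡ rim i
      t-class w cw = spoke-class i w (trans cw (sym spoke-to-hub))

      singleton : ∀ k → k ≢ i → ∀ w → c w ≡ cv k → w ≡ rim k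
      singleton k k≢i w cw with spoke-target k
      ... | inj₁ a≡t with spoke-class k (rim i) (trans (sym t≡cv) (sym a≡t))
      ...   | inj₂ i≡k = ⊥-elim (k≢i (sym (rim-injective i≡k)))
      singleton k k≢i w cw | inj₂ a≡cv with spoke-class k w (trans cw (sym a≡cv))
      ...   | inj₂ w≡rim = w≡rim
      ...   | inj₁ refl = ⊥-elim (no-pair⇒rims-distinct no-pair k≢i (trans (sym cw) t≡cv))

      no-mid-has-original-colour : NoMidHasOriginalColour
      no-mid-has-original-colour e zero ce with t-class (inj₂ e) ce
      ... | inj₁ ()
      ... | inj₂ ()
      no-mid-has-original-colour e (suc u) ce with u ≟ i
      ... | no u≢i = mid≢rim (singleton u u≢i (inj₂ e) ce)
      ... | yes refl with t-class (inj₂ e) (trans ce (sym t≡cv))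
      ...   | inj₁ ()
      ...   | inj₂ ()

    spare-colour : ∀ {k l} → k ≢ l →
      Σ (Fin j) λ z → NonOriginal z × z ≢ x × (z ≡ target (rim k) ⊎ z ≡ target (rim l))
    spare-colour {k} {l} k≢l with target (rim k) ≟ x | target (rim l) ≟ x
    ... | no yk≢x | _ = target (rim k) , target-nonOriginal (suc k) , yk≢x , inj₁ refl
    ... | yes _ | no yl≢x = target (rim l) , target-nonOriginal (suc l) , yl≢x , inj₂ refl
    ... | yes yk≡x | yes yl≡x = ⊥-elim (no-two-rims-share-hub-target k≢l yk≡x yl≡x)

    mid-shares-original-colour : (∃ λ e → ∃ λ u → c (inj₂ e) ≡ c (inj₁ u)) → 6 ≤ j
    mid-shares-original-colour (e , u , shared) =
      colours-≤ {t ∷ cv r₀ ∷ cv r₁ ∷ cv r₂ ∷ []} {x ∷ z ∷ []}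
        ((t≢cv r₀ ∷ t≢cv r₁ ∷ t≢cv r₂ ∷ []) ∷ (rims-distinct (λ ()) ∷ rims-distinct (λ ()) ∷ [])
          ∷ (rims-distinct (λ ()) ∷ []) ∷ [] ∷ [])
        ((zero , refl) ∷ (suc r₀ , refl) ∷ (suc r₁ , refl) ∷ (suc r₂ , refl) ∷ [])
        (((proj₁ (proj₂ (proj₂ spare)) ∘ sym) ∷ []) ∷ [] ∷ [])
        (target-nonOriginal zero ∷ proj₁ (proj₂ spare) ∷ [])
      where
      r₀ r₁ r₂ : Rim
      r₀ = zero
      r₁ = suc zero
      r₂ = suc (suc zero)
      no-pair : ∀ k → cv k ≢ cv (next k)
      no-pair k pair = Pair.no-mid-has-original-colour k pair e u shared
      rims-distinct = no-pair⇒rims-distinct no-pair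
      t≢cv : ∀ i → t ≢ cv i
      t≢cv i t≡cv = HubShares.no-mid-has-original-colour i t≡cv no-pair e u shared
      spare = spare-colour {r₀} {r₁} (λ ())
      z = proj₁ spare

    three-original-colours : ThreeOriginalColours
    three-original-colours with any? (λ k → cv k ≟ cv (next k))
    ... | yes (k , pair) = Pair.three-original-colours k pair
    ... | no ¬pair = record
      { u₁ = suc zero ; u₂ = suc (suc zero) ; u₃ = suc (suc (suc zero))
      ; distinct = (rims-distinct (λ ()) ∷ rims-distinct (λ ()) ∷ []) ∷ (rims-distinct (λ ()) ∷ []) ∷ [] ∷ [] }
      where
      rims-distinct = no-pair⇒rims-distinct (λ k pair → ¬pair (k , pair))

    third-non-original-colour : (∀ k → NonOriginal (c (rimMid k))) →
                                Σ (Fin j) λ z → NonOriginal z × x ≢ z × c (rimMid zero) ≢ z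
    third-non-original-colour fresh with all? (λ k → c (rimMid k) ≟ c (rimMid zero))
    ... | no ¬all with ¬∀⟶∃¬ _ _ (λ k → c (rimMid k) ≟ c (rimMid zero)) ¬all
    ...   | k , ρₖ≢ρ = c (rimMid k) , fresh k , rimMid≢target-hub k ∘ sym , ρₖ≢ρ ∘ sym
    third-non-original-colour fresh | yes all-ρ with spare-colour {zero} {next zero} (next≢ zero ∘ sym)
    ...   | z , z-non , z≢x , z-is-target = z , z-non , z≢x ∘ sym , ρ≢target z-is-target
      where
      target≢ρ : ∀ k → target (rim k) ≢ c (rimMid zero)
      target≢ρ k yk≡ρ with rimMid-neighbours (next k) (rim k)
        (~mid-sym {e = rimEdge (next k)} (target-class (rimMid (next k)) (trans (all-ρ (next k)) (sym yk≡ρ))))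
      ... | inj₁ k≡k⁺ = next≢ k (sym (rim-injective k≡k⁺))
      ... | inj₂ k≡k⁺⁺ = next²≢ k (sym (rim-injective k≡k⁺⁺))
      ρ≢target : ∀ {k l} → z ≡ target (rim k) ⊎ z ≡ target (rim l) → c (rimMid zero) ≢ z
      ρ≢target (inj₁ refl) = target≢ρ _ ∘ sym
      ρ≢target (inj₂ refl) = target≢ρ _ ∘ sym

    arcs-avoid-original-colours : (∀ k → NonOriginal (c (rimMid k))) → 6 ≤ j
    arcs-avoid-original-colours fresh with third-non-original-colour fresh
    ... | z , z-non , x≢z , ρ≢z =
      colours-≤ {ys = x ∷ c (rimMid zero) ∷ z ∷ []} distinct (original ∷ original ∷ original ∷ [])
        (((rimMid≢target-hub zero ∘ sym) ∷ x≢z ∷ []) ∷ (ρ≢z ∷ []) ∷ [] ∷ [])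
        (target-nonOriginal zero ∷ fresh zero ∷ z-non ∷ [])
      where
      open ThreeOriginalColours three-original-colours
      original : ∀ {u} → Original (c (inj₁ u))
      original {u} = u , refl

    lower-bound : 6 ≤ j
    lower-bound with any? (λ u → any? (λ k → c (rimMid k) ≟ c (inj₁ u)))
    ... | yes (u , k , shared) = mid-shares-original-colour (rimEdge k , u , shared)
    ... | no ¬shared = arcs-avoid-original-colours (λ k u shared → ¬shared (u , k , sym shared))

-- Positions 3i and 3i+1 (i < q) share colour 2i, position 3i+2 gets 2i+1, and the
-- remaining positions 3q + s get the fresh colours 2q + s.
module BlockColouring (q : ℕ) where

  [_≡2] : ℕ → ℕ
  [ 2 ≡2] = 1
  [ _ ≡2] = 0

  [u≡2]≤1 : ∀ u → [ u ≡2] ≤ 1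
  [u≡2]≤1 0 = z≤n
  [u≡2]≤1 1 = z≤n
  [u≡2]≤1 2 = s≤s z≤n
  [u≡2]≤1 (suc (suc (suc _))) = z≤n

  blockColour : ℕ → ℕ
  blockColour a with a <? q * 3
  ... | yes _ = (a / 3) * 2 + [ a % 3 ≡2]
  ... | no _ = a ∸ q

  blockColour-inside : ∀ {a} → a < q * 3 → blockColour a ≡ (a / 3) * 2 + [ a % 3 ≡2]
  blockColour-inside {a} a<3q with a <? q * 3
  ... | yes _ = refl
  ... | no a≮3q = ⊥-elim (a≮3q a<3q)

  blockColour-outside : ∀ {a} → ¬ a < q * 3 → blockColour a ≡ a ∸ q
  blockColour-outside {a} a≮3q with a <? q * 3
  ... | yes a<3q = ⊥-elim (a≮3q a<3q)
  ... | no _ = refl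

  blockColour-inside-< : ∀ {a} → a < q * 3 → blockColour a < q * 2
  blockColour-inside-< {a} a<3q = begin-strict
    blockColour a                ≡⟨ blockColour-inside a<3q ⟩
    (a / 3) * 2 + [ a % 3 ≡2]    ≤⟨ +-monoʳ-≤ ((a / 3) * 2) ([u≡2]≤1 (a % 3)) ⟩
    (a / 3) * 2 + 1              <⟨ +-monoʳ-< ((a / 3) * 2) (s≤s (s≤s z≤n)) ⟩
    (a / 3) * 2 + 2              ≡⟨ +-comm ((a / 3) * 2) 2 ⟩
    suc (a / 3) * 2              ≤⟨ *-monoˡ-≤ 2 (m<n*o⇒m/o<n {n = q} a<3q) ⟩
    q * 2                        ∎
    where open ≤-Reasoning

  q≤outside : ∀ {a} → ¬ a < q * 3 → q ≤ a
  q≤outside a≮3q = ≤-trans (m≤m*n q 3) (≮⇒≥ a≮3q)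

  blockColour-< : ∀ r {a} → a < q * 3 + r → blockColour a < q * 2 + r
  blockColour-< r {a} a<n = by-position (a <? q * 3)
    where
    open ≤-Reasoning
    regroup : ∀ q r → q * 3 + r ≡ q * 2 + r + q
    regroup = solve-∀
    by-position : Dec (a < q * 3) → blockColour a < q * 2 + r
    by-position (yes a<3q) = ≤-trans (blockColour-inside-< a<3q) (m≤m+n (q * 2) r)
    by-position (no a≮3q) = begin-strict
      blockColour a  ≡⟨ blockColour-outside a≮3q ⟩
      a ∸ q          <⟨ +-cancelʳ-< q (a ∸ q) (q * 2 + r) (subst₂ _<_ (sym (m∸n+n≡m (q≤outside a≮3q))) (regroup q r) a<n) ⟩
      q * 2 + r      ∎

  PairStart : ℕ → Set
  PairStart a = a < q * 3 × a % 3 ≡ 0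

  pairStart? : ∀ a → Dec (PairStart a)
  pairStart? a with a <? q * 3 | a % 3 ℕ.≟ 0
  ... | yes a<3q | yes a≡0 = yes (a<3q , a≡0)
  ... | no a≮3q | _ = no (a≮3q ∘ proj₁)
  ... | yes _ | no a≢0 = no (a≢0 ∘ proj₂)

  euclid : ∀ a → a ≡ a % 3 + (a / 3) * 3
  euclid a = m≡m%n+[m/n]*n a 3

  pairStart-multiple : ∀ {a} → PairStart a → a ≡ (a / 3) * 3
  pairStart-multiple {a} (_ , a%3≡0) = trans (euclid a) (cong (_+ (a / 3) * 3) a%3≡0)

  pairStart-room : ∀ {a} → PairStart a → suc (suc a) < q * 3
  pairStart-room {a} a-start = begin-strict
    suc (suc a)               ≡⟨ cong (ℕ.suc ∘ ℕ.suc) (pairStart-multiple a-start) ⟩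
    suc (suc ((a / 3) * 3))   <⟨ s≤s (s≤s (s≤s ≤-refl)) ⟩
    suc (a / 3) * 3           ≤⟨ *-monoˡ-≤ 3 (m<n*o⇒m/o<n {n = q} (proj₁ a-start)) ⟩
    q * 3                     ∎
    where
    open ≤-Reasoning

  pairStart-offset : ∀ {a} u → u < 3 → PairStart a → (u + a) % 3 ≡ u
  pairStart-offset {a} u u<3 a-start = begin
    (u + a) % 3              ≡⟨ cong (λ z → (u + z) % 3) (pairStart-multiple a-start) ⟩
    (u + (a / 3) * 3) % 3    ≡⟨ [m+kn]%n≡m%n u (a / 3) 3 ⟩
    u % 3                    ≡⟨ m<n⇒m%n≡m u<3 ⟩
    u                        ∎
    where open ≡-Reasoning

  *2+-injective : ∀ i i′ f f′ → f ≤ 1 → f′ ≤ 1 → i * 2 + f ≡ i′ * 2 + f′ → i ≡ i′ × f ≡ f′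
  *2+-injective zero zero f f′ _ _ eq = refl , eq
  *2+-injective zero (suc i′) zero f′ _ _ ()
  *2+-injective zero (suc i′) (suc zero) f′ _ _ ()
  *2+-injective zero (suc i′) (suc (suc f)) f′ (s≤s ()) _ _
  *2+-injective (suc i) zero f zero _ _ ()
  *2+-injective (suc i) zero f (suc zero) _ _ ()
  *2+-injective (suc i) zero f (suc (suc f′)) _ (s≤s ()) _
  *2+-injective (suc i) (suc i′) f f′ f≤1 f′≤1 eq =
    let i≡i′ , f≡f′ = *2+-injective i i′ f f′ f≤1 f′≤1 (ℕₚ.suc-injective (ℕₚ.suc-injective eq))
    in cong suc i≡i′ , f≡f′

  [≡2]-collision : ∀ {u u′} → u < 3 → u′ < 3 → u < u′ → [ u ≡2] ≡ [ u′ ≡2] → u ≡ 0 × u′ ≡ 1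
  [≡2]-collision {0} {1} _ _ _ _ = refl , refl
  [≡2]-collision {0} {2} _ _ _ ()
  [≡2]-collision {1} {2} _ _ _ ()
  [≡2]-collision {1} {1} _ _ (s≤s ()) _
  [≡2]-collision {2} {2} _ _ (s≤s (s≤s ())) _
  [≡2]-collision {2} {1} _ _ (s≤s ()) _
  [≡2]-collision {suc (suc (suc _))} (s≤s (s≤s (s≤s ()))) _ _ _
  [≡2]-collision {_} {suc (suc (suc _))} _ (s≤s (s≤s (s≤s ()))) _ _

  blocks-same : ∀ {a b} → a < b → (a / 3) * 2 + [ a % 3 ≡2] ≡ (b / 3) * 2 + [ b % 3 ≡2] → a % 3 ≡ 0 × b ≡ suc a
  blocks-same {a} {b} a<b same = proj₁ rems , b≡1+a
    where
    blocks = *2+-injective (a / 3) (b / 3) _ _ ([u≡2]≤1 (a % 3)) ([u≡2]≤1 (b % 3)) same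
    a/3≡b/3 = proj₁ blocks
    a%3<b%3 : a % 3 < b % 3
    a%3<b%3 = +-cancelʳ-< ((a / 3) * 3) (a % 3) (b % 3)
      (subst₂ _<_ (euclid a) (trans (euclid b) (cong (λ z → b % 3 + z * 3) (sym a/3≡b/3))) a<b)
    rems = [≡2]-collision (m%n<n a 3) (m%n<n b 3) a%3<b%3 (proj₂ blocks)
    b≡1+a : b ≡ suc a
    b≡1+a = begin
      b                         ≡⟨ euclid b ⟩
      b % 3 + (b / 3) * 3       ≡⟨ cong₂ (λ u v → u + v * 3) (proj₂ rems) (sym a/3≡b/3) ⟩
      suc ((a / 3) * 3)         ≡⟨ cong (ℕ.suc ∘ (_+ (a / 3) * 3)) (sym (proj₁ rems)) ⟩
      suc (a % 3 + (a / 3) * 3) ≡⟨ cong suc (euclid a) ⟨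
      suc a                     ∎
      where open ≡-Reasoning

  inside<outside : ∀ {a b} → a < q * 3 → ¬ b < q * 3 → blockColour a < blockColour b
  inside<outside {a} {b} a<3q b≮3q = begin-strict
    blockColour a   <⟨ blockColour-inside-< a<3q ⟩
    q * 2           ≡⟨ trans (cong (_∸ q) (regroup q)) (m+n∸n≡m (q * 2) q) ⟨
    q * 3 ∸ q       ≤⟨ ∸-monoˡ-≤ q (≮⇒≥ b≮3q) ⟩
    b ∸ q           ≡⟨ blockColour-outside b≮3q ⟨
    blockColour b   ∎
    where
    open ≤-Reasoning
    regroup : ∀ q → q * 3 ≡ q * 2 + q
    regroup = solve-∀

  outside-injective : ∀ {a b} → ¬ a < q * 3 → ¬ b < q * 3 → blockColour a ≡ blockColour b → a ≡ b
  outside-injective {a} {b} a≮3q b≮3q same = begin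
    a            ≡⟨ m∸n+n≡m (q≤outside a≮3q) ⟨
    a ∸ q + q    ≡⟨ cong (_+ q) (trans (sym (blockColour-outside a≮3q)) (trans same (blockColour-outside b≮3q))) ⟩
    b ∸ q + q    ≡⟨ m∸n+n≡m (q≤outside b≮3q) ⟩
    b            ∎
    where open ≡-Reasoning

  blockColour-same : ∀ {a b} → a < b → blockColour a ≡ blockColour b → PairStart a × b ≡ suc a
  blockColour-same {a} {b} a<b same = by-position (a <? q * 3) (b <? q * 3)
    where
    by-position : Dec (a < q * 3) → Dec (b < q * 3) → PairStart a × b ≡ suc a
    by-position (yes a<3q) (yes b<3q) =
      let a%3≡0 , b≡1+a = blocks-same a<b (trans (sym (blockColour-inside a<3q)) (trans same (blockColour-inside b<3q)))
      in (a<3q , a%3≡0) , b≡1+a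
    by-position (yes a<3q) (no b≮3q) = ⊥-elim (<-irrefl same (inside<outside a<3q b≮3q))
    by-position (no a≮3q) (yes b<3q) = ⊥-elim (a≮3q (<-trans a<b b<3q))
    by-position (no a≮3q) (no b≮3q) = ⊥-elim (<-irrefl (outside-injective a≮3q b≮3q same) a<b)

module BlockRim (q r m : ℕ) (size : 3 + m ≡ q * 3 + r) (2≤q : 2 ≤ q) where

  open BlockColouring q
  open CentralWheel m using (Rim; RimColouring)

  3q≤n : q * 3 ≤ 3 + m
  3q≤n = subst (q * 3 ≤_) (sym size) (m≤m+n (q * 3) r)

  colour : Rim → Fin (q * 2 + r)
  colour k = fromℕ< (blockColour-< r (subst (toℕ k <_) size (toℕ<n k)))

  colour-same : ∀ {k l} → colour k ≡ colour l → blockColour (toℕ k) ≡ blockColour (toℕ l)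
  colour-same {k} {l} same = trans (sym (toℕ-fromℕ< _)) (trans (cong toℕ same) (toℕ-fromℕ< _))

  next-inside : ∀ k → suc (toℕ k) < 3 + m → toℕ (next k) ≡ suc (toℕ k)
  next-inside k 1+k<n with toℕ-next k
  ... | inj₁ next≡1+k = next≡1+k
  ... | inj₂ (k≡last , _) = ⊥-elim (<-irrefl refl (subst (λ z → suc z < 3 + m) k≡last 1+k<n))

  same-colour⇒consecutive : ∀ k l → colour k ≡ colour l → k ≡ l ⊎ l ≡ next k ⊎ k ≡ next l
  same-colour⇒consecutive k l same with <-cmp (toℕ k) (toℕ l)
  ... | tri< k<l _ _ = inj₂ (inj₁ (next-of-suc k l (proj₂ (blockColour-same k<l (colour-same same)))))
  ... | tri≈ _ k≡l _ = inj₁ (toℕ-injective k≡l)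
  ... | tri> _ _ l<k = inj₂ (inj₂ (next-of-suc l k (proj₂ (blockColour-same l<k (colour-same (sym same))))))

  pair-class : ∀ k → PairStart (toℕ k) → ∀ l → colour l ≡ colour k → l ≡ k ⊎ l ≡ next k
  pair-class k k-start l same with <-cmp (toℕ l) (toℕ k)
  ... | tri≈ _ l≡k _ = inj₁ (toℕ-injective l≡k)
  ... | tri> _ _ k<l = inj₂ (next-of-suc k l (proj₂ (blockColour-same k<l (colour-same (sym same)))))
  ... | tri< l<k _ _ with blockColour-same l<k (colour-same same)
  ...   | l-start , k≡1+l = ⊥-elim (1≢0 (trans (sym (pairStart-offset 1 (s≤s (s≤s z≤n)) l-start))
                                          (trans (cong (_% 3) (sym k≡1+l)) (proj₂ k-start))))
    where
    1≢0 : 1 ≢ 0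
    1≢0 ()

  singleton-class : ∀ k → ¬ PairStart (toℕ k) → (∀ l → suc (toℕ l) ≡ toℕ k → ¬ PairStart (toℕ l)) →
                    ∀ l → colour l ≡ colour k → l ≡ k
  singleton-class k k-not pred-not l same with <-cmp (toℕ l) (toℕ k)
  ... | tri≈ _ l≡k _ = toℕ-injective l≡k
  ... | tri> _ _ k<l = ⊥-elim (k-not (proj₁ (blockColour-same k<l (colour-same (sym same)))))
  ... | tri< l<k _ _ with blockColour-same l<k (colour-same same)
  ...   | l-start , k≡1+l = ⊥-elim (pred-not l (sym k≡1+l) l-start)

  0-start : PairStart 0
  0-start = ≤-trans (s≤s z≤n) (*-monoˡ-≤ 3 2≤q) , refl

  arc-class : ∀ k → ∃ λ d → ∀ l → colour l ≡ colour d → l ≡ k ⊎ l ≡ next k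
  arc-class k with pairStart? (toℕ k)
  ... | yes k-start = k , pair-class k k-start
  ... | no k-not = after-non-start (toℕ k) refl
    where
    after-non-start : ∀ a → toℕ k ≡ a → ∃ λ d → ∀ l → colour l ≡ colour d → l ≡ k ⊎ l ≡ next k
    after-non-start zero k≡0 = ⊥-elim (k-not (subst PairStart (sym k≡0) 0-start))
    after-non-start (suc a) k≡1+a with pairStart? a
    ... | no a-not = k , λ l same → inj₁ (singleton-class k k-not pred-not l same)
      where
      pred-not : ∀ l → suc (toℕ l) ≡ toℕ k → ¬ PairStart (toℕ l)
      pred-not l 1+l≡k = subst (¬_ ∘ PairStart) (sym (ℕₚ.suc-injective (trans 1+l≡k k≡1+a))) a-not
    ... | yes a-start = next k , λ l same → inj₂ (singleton-class (next k) k⁺-not pred-not l same)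
      where
      k⁺≡2+a : toℕ (next k) ≡ suc (suc a)
      k⁺≡2+a = trans (next-inside k (<-≤-trans (subst (λ z → suc z < q * 3) (sym k≡1+a) (pairStart-room a-start)) 3q≤n))
                     (cong suc k≡1+a)
      k⁺-not : ¬ PairStart (toℕ (next k))
      k⁺-not k⁺-start = 2≢0 (trans (sym (pairStart-offset 2 (s≤s (s≤s (s≤s z≤n))) a-start))
                                   (trans (cong (_% 3) (sym k⁺≡2+a)) (proj₂ k⁺-start)))
        where
        2≢0 : 2 ≢ 0
        2≢0 ()
      pred-not : ∀ l → suc (toℕ l) ≡ toℕ (next k) → ¬ PairStart (toℕ l)
      pred-not l 1+l≡k⁺ =
        subst (¬_ ∘ PairStart) (sym (ℕₚ.suc-injective (trans 1+l≡k⁺ (trans k⁺≡2+a (cong suc (sym k≡1+a)))))) k-not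

  far-class : ∀ i → ∃ λ d → ∀ l → colour l ≡ colour d → i ≢ l × l ≢ next i × i ≢ next l
  far-class i = rotate 3 i , far
    where
    i⁺ : ℕ → Rim
    i⁺ a = rotate a i
    next-i⁺ : ∀ a → next (i⁺ a) ≡ i⁺ (a + 1)
    next-i⁺ a = rotate-rotate 1 a i
    apart : ∀ a b → {_ : True (a <? b)} {_ : True (b <? 6)} → i⁺ a ≢ i⁺ b
    apart a b {a<b} {b<6} = rotate-distinct i (toWitness a<b) (<-≤-trans (toWitness b<6) (≤-trans (*-monoˡ-≤ 3 2≤q) 3q≤n))
    i≢i⁺ : ∀ b → {_ : True (0 <? b)} {_ : True (b <? 6)} → i ≢ i⁺ b
    i≢i⁺ b {0<b} {b<6} = apart 0 b {0<b} {b<6} ∘ trans (rotate-zero i)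
    i⁺≢next-i : ∀ b → {_ : True (1 <? b)} {_ : True (b <? 6)} → i⁺ b ≢ next i
    i⁺≢next-i b {1<b} {b<6} = apart 1 b {1<b} {b<6} ∘ sym
    far : ∀ l → colour l ≡ colour (i⁺ 3) → i ≢ l × l ≢ next i × i ≢ next l
    far l same with same-colour⇒consecutive (i⁺ 3) l (sym same)
    ... | inj₁ refl = i≢i⁺ 3 , i⁺≢next-i 3 , i≢i⁺ 4 ∘ (λ e → trans e (next-i⁺ 3))
    ... | inj₂ (inj₁ refl) = i≢i⁺ 4 ∘ (λ e → trans e (next-i⁺ 3))
                           , i⁺≢next-i 4 ∘ trans (sym (next-i⁺ 3))
                           , i≢i⁺ 5 ∘ (λ e → trans e (trans (cong next (next-i⁺ 3)) (next-i⁺ 4)))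
    ... | inj₂ (inj₂ r₃≡l⁺) with next-injective (trans (next-i⁺ 2) r₃≡l⁺)
    ...   | refl = i≢i⁺ 2 , i⁺≢next-i 2 , i≢i⁺ 3 ∘ (λ e → trans e (next-i⁺ 2))

  blockRimColouring : RimColouring (q * 2 + r)
  blockRimColouring = record
    { colour = colour
    ; same-colour⇒consecutive = same-colour⇒consecutive
    ; arc-class = arc-class
    ; far-class = far-class }

-- Certified colourings of the small wheels

module Certified {N K : ℕ} (adj : Fin N → Fin N → Bool) (vertexColour : Fin N → Fin K) (edgeColour : Fin N → Fin N → Fin K) where

  ProperOnOriginals : Set
  ProperOnOriginals = ∀ a b → a ≡ b ⊎ adj a b ≡ true ⊎ vertexColour a ≢ vertexColour b

  SeparateColours : Set
  SeparateColours = ∀ a i k → vertexColour a ≢ edgeColour i k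

  EdgesDominate : Set
  EdgesDominate = ∀ i k → toℕ i < toℕ k → adj i k ≡ true →
    ∃ λ u → ∀ u′ → vertexColour u′ ≡ vertexColour u → u′ ≡ i ⊎ u′ ≡ k

  DominatesOriginals DominatesEdges : Fin N → Set
  DominatesOriginals a = ∃ λ u → ∀ u′ → vertexColour u′ ≡ vertexColour u → a ≢ u′ × adj a u′ ≡ false
  DominatesEdges a = ∃ λ i → ∃ λ k → toℕ i < toℕ k × adj i k ≡ true ×
    (∀ i′ k′ → toℕ i′ < toℕ k′ → adj i′ k′ ≡ true → edgeColour i′ k′ ≡ edgeColour i k → a ≡ i′ ⊎ a ≡ k′)

  Certificate : Set
  Certificate = ProperOnOriginals × SeparateColours × EdgesDominate × (∀ a → DominatesOriginals a ⊎ DominatesEdges a)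

  certificate? : Dec Certificate
  certificate? = proper? ×-dec separate? ×-dec edges? ×-dec (all? λ a → originals? a ⊎-dec edges-of? a)
    where
    proper? = all? λ a → all? λ b → (a ≟ b) ⊎-dec ((adj a b Bool.≟ true) ⊎-dec ¬? (vertexColour a ≟ vertexColour b))
    separate? = all? λ a → all? λ i → all? λ k → ¬? (vertexColour a ≟ edgeColour i k)
    edges? = all? λ i → all? λ k → (toℕ i <? toℕ k) →-dec ((adj i k Bool.≟ true) →-dec
               any? λ u → all? λ u′ → (vertexColour u′ ≟ vertexColour u) →-dec ((u′ ≟ i) ⊎-dec (u′ ≟ k)))
    originals? = λ a → any? λ u → all? λ u′ →
                   (vertexColour u′ ≟ vertexColour u) →-dec (¬? (a ≟ u′) ×-dec (adj a u′ Bool.≟ false))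
    edges-of? = λ a → any? λ i → any? λ k → (toℕ i <? toℕ k) ×-dec ((adj i k Bool.≟ true) ×-dec
                  (all? λ i′ → all? λ k′ → (toℕ i′ <? toℕ k′) →-dec ((adj i′ k′ Bool.≟ true) →-dec
                     ((edgeColour i′ k′ ≟ edgeColour i k) →-dec ((a ≟ i′) ⊎-dec (a ≟ k′))))))

  certified⇒TDC : Certificate → HasTDC (Central N adj) K
  certified⇒TDC (proper , separate , edges , originals) = colour , colour-proper , colour-dominating
    where
    colour : V (Central N adj) → Fin K
    colour (inj₁ a) = vertexColour a
    colour (inj₂ ((i , k) , _)) = edgeColour i k

    colour-proper : ∀ u w → E (Central N adj) u w → colour u ≢ colour w
    colour-proper (inj₁ a) (inj₁ b) (a≢b , nonadjacent) same with proper a b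
    ... | inj₁ a≡b = a≢b a≡b
    ... | inj₂ (inj₁ adjacent) with trans (sym adjacent) nonadjacent
    ...   | ()
    colour-proper (inj₁ a) (inj₁ b) _ same | inj₂ (inj₂ different) = different same
    colour-proper (inj₁ a) (inj₂ ((i , k) , _)) _ = separate a i k
    colour-proper (inj₂ ((i , k) , _)) (inj₁ a) _ = separate a i k ∘ sym

    colour-dominating : ∀ u → ∃ λ z → (∃ λ w → colour w ≡ z) × (∀ w → colour w ≡ z → E (Central N adj) u w)
    colour-dominating (inj₁ a) with originals a
    ... | inj₁ (u , far) = vertexColour u , (inj₁ u , refl) , class
      where
      class : ∀ w → colour w ≡ vertexColour u → E (Central N adj) (inj₁ a) w
      class (inj₁ u′) same = far u′ same
      class (inj₂ ((i , k) , _)) same = ⊥-elim (separate u i k (sym same))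
    ... | inj₂ (i , k , i<k , adjacent , incident) = edgeColour i k , (inj₂ ((i , k) , i<k , adjacent) , refl) , class
      where
      class : ∀ w → colour w ≡ edgeColour i k → E (Central N adj) (inj₁ a) w
      class (inj₁ u′) same = ⊥-elim (separate u′ i k same)
      class (inj₂ ((i′ , k′) , i′<k′ , adjacent′)) same = incident i′ k′ i′<k′ adjacent′ same
    colour-dominating (inj₂ ((i , k) , i<k , adjacent)) with edges i k i<k adjacent
    ... | u , ends = vertexColour u , (inj₁ u , refl) , class
      where
      class : ∀ w → colour w ≡ vertexColour u → E (Central N adj) (inj₂ ((i , k) , i<k , adjacent)) w
      class (inj₁ u′) same = ends u′ same
      class (inj₂ ((i′ , k′) , _)) same = ⊥-elim (separate u i′ k′ (sym same))

wheel₃-TDC : HasTDC (Central 4 (wheelAdj 3)) 6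
wheel₃-TDC = certified⇒TDC (from-yes certificate?)
  where
  edgeColour : Fin 4 → Fin 4 → Fin 6
  edgeColour zero (suc zero) = # 3
  edgeColour (suc (suc zero)) (suc (suc (suc zero))) = # 4
  edgeColour _ _ = # 5
  open Certified (wheelAdj 3) (lookup (# 0 ∷ # 0 ∷ # 1 ∷ # 2 ∷ [])) edgeColour

wheel₄-TDC : HasTDC (Central 5 (wheelAdj 4)) 6
wheel₄-TDC = certified⇒TDC (from-yes certificate?)
  where
  edgeColour : Fin 5 → Fin 5 → Fin 6
  edgeColour zero (suc (suc (suc zero))) = # 5
  edgeColour _ _ = # 4
  open Certified (wheelAdj 4) (lookup (# 0 ∷ # 0 ∷ # 1 ∷ # 2 ∷ # 3 ∷ [])) edgeColour

wheel₅-TDC : HasTDC (Central 6 (wheelAdj 5)) 7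
wheel₅-TDC = certified⇒TDC (from-yes certificate?)
  where
  edgeColour : Fin 6 → Fin 6 → Fin 7
  edgeColour zero _ = # 1
  edgeColour (suc _) _ = # 2
  open Certified (wheelAdj 5) (lookup (# 0 ∷ # 3 ∷ # 3 ∷ # 4 ∷ # 5 ∷ # 6 ∷ [])) edgeColour

χ : ℕ → ℕ
χ n = 3 + ((n / 3) * 2 + n % 3)

euclid₃ : ∀ n → n ≡ (n / 3) * 3 + n % 3
euclid₃ n = trans (m≡m%n+[m/n]*n n 3) (+-comm (n % 3) _)

3χ≤2n+11 : ∀ n → 3 * χ n ≤ 2 * n + 11
3χ≤2n+11 n = begin
  3 * χ n                           ≡⟨ expand (n / 3) (n % 3) ⟩
  (n / 3) * 6 + n % 3 * 2 + 9 + n % 3 ≤⟨ +-monoʳ-≤ ((n / 3) * 6 + n % 3 * 2 + 9) (s≤s⁻¹ (m%n<n n 3)) ⟩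
  (n / 3) * 6 + n % 3 * 2 + 9 + 2   ≡⟨ collect (n / 3) (n % 3) ⟩
  2 * ((n / 3) * 3 + n % 3) + 11    ≡⟨ cong (λ z → 2 * z + 11) (euclid₃ n) ⟨
  2 * n + 11                        ∎
  where
  open ≤-Reasoning
  expand : ∀ q r → 3 * (3 + (q * 2 + r)) ≡ q * 6 + r * 2 + 9 + r
  expand = solve-∀
  collect : ∀ q r → q * 6 + r * 2 + 9 + 2 ≡ 2 * (q * 3 + r) + 11
  collect = solve-∀

2n+9≤3j⇒χ≤j : ∀ n j → 2 * n + 9 ≤ 3 * j → χ n ≤ j
2n+9≤3j⇒χ≤j n j 2n+9≤3j = s≤s⁻¹ (*-cancelˡ-< 3 (χ n) (suc j) (begin-strict
  3 * χ n      ≤⟨ 3χ≤2n+11 n ⟩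
  2 * n + 11   ≡⟨ +-assoc (2 * n) 9 2 ⟨
  2 * n + 9 + 2 ≤⟨ +-monoˡ-≤ 2 2n+9≤3j ⟩
  3 * j + 2    <⟨ +-monoʳ-< (3 * j) (s≤s (s≤s (s≤s z≤n))) ⟩
  3 * j + 3    ≡⟨ trans (*-suc 3 j) (+-comm 3 (3 * j)) ⟨
  3 * suc j    ∎))
  where open ≤-Reasoning

-- The block colouring needs two full blocks.
wheel-upper : ∀ k → HasTDC (Central (5 + k) (wheelAdj (4 + k))) (χ (4 + k))
wheel-upper 0 = wheel₄-TDC
wheel-upper 1 = wheel₅-TDC
wheel-upper (suc (suc k)) =
  CentralWheel.rimColouring⇒TDC (3 + k) (BlockRim.blockRimColouring (n / 3) (n % 3) (3 + k) (euclid₃ n) (/-monoˡ-≤ 3 6≤n))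
  where
  n = 6 + k
  6≤n : 6 ≤ n
  6≤n = m≤m+n 6 k

wheel-χ : ∀ k → TDChromatic (Central (5 + k) (wheelAdj (4 + k))) (χ (4 + k))
wheel-χ k = wheel-upper k , λ j j<χ (c , tdc) → <⇒≱ j<χ (2n+9≤3j⇒χ≤j (4 + k) j (LowerBound.lower-bound k c tdc))

wheel₃-χ : TDChromatic (Central 4 (wheelAdj 3)) 6
wheel₃-χ = wheel₃-TDC , λ j j<6 (c , tdc) → <⇒≱ j<6 (TriangleLowerBound.lower-bound c tdc)

[2n]/3≡ : ∀ n → (2 * n) / 3 ≡ (n / 3) * 2 + (2 * (n % 3)) / 3
[2n]/3≡ n = begin
  (2 * n) / 3                                   ≡⟨ cong (λ z → (2 * z) / 3) (euclid₃ n) ⟩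
  (2 * ((n / 3) * 3 + n % 3)) / 3               ≡⟨ cong (_/ 3) (regroup (n / 3) (n % 3)) ⟩
  (2 * (n % 3) + (n / 3) * 2 * 3) / 3           ≡⟨ +-distrib-/-∣ʳ (2 * (n % 3)) (divides ((n / 3) * 2) refl) ⟩
  (2 * (n % 3)) / 3 + (n / 3) * 2 * 3 / 3       ≡⟨ cong ((2 * (n % 3)) / 3 +_) (m*n/n≡m ((n / 3) * 2) 3) ⟩
  (2 * (n % 3)) / 3 + (n / 3) * 2               ≡⟨ +-comm ((2 * (n % 3)) / 3) _ ⟩
  (n / 3) * 2 + (2 * (n % 3)) / 3               ∎
  where
  open ≡-Reasoning
  regroup : ∀ q r → 2 * (q * 3 + r) ≡ 2 * r + q * 2 * 3
  regroup = solve-∀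

χ-formula : ∀ n → (n % 3 ≡ 0 → (2 * n) / 3 + 3 ≡ χ n) × (n % 3 ≢ 0 → (2 * n) / 3 + 4 ≡ χ n)
χ-formula n rewrite [2n]/3≡ n = by-remainder (n % 3) (m%n<n n 3)
  where
  by-remainder : ∀ r → r < 3 → (r ≡ 0 → (n / 3) * 2 + (2 * r) / 3 + 3 ≡ 3 + ((n / 3) * 2 + r))
                               × (r ≢ 0 → (n / 3) * 2 + (2 * r) / 3 + 4 ≡ 3 + ((n / 3) * 2 + r))
  by-remainder 0 _ = (λ _ → shuffle₀ (n / 3)) , (λ r≢0 → ⊥-elim (r≢0 refl))
    where
    shuffle₀ : ∀ q → q * 2 + 0 + 3 ≡ 3 + (q * 2 + 0)
    shuffle₀ = solve-∀
  by-remainder 1 _ = (λ ()) , (λ _ → shuffle₁ (n / 3))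
    where
    shuffle₁ : ∀ q → q * 2 + 0 + 4 ≡ 3 + (q * 2 + 1)
    shuffle₁ = solve-∀
  by-remainder 2 _ = (λ ()) , (λ _ → shuffle₂ (n / 3))
    where
    shuffle₂ : ∀ q → q * 2 + 1 + 4 ≡ 3 + (q * 2 + 2)
    shuffle₂ = solve-∀
  by-remainder (suc (suc (suc _))) (s≤s (s≤s (s≤s ())))

proposition5p3 : (n : ℕ) → 3 ≤ n →
    ((n % 3 ≡ 0) × (n ≢ 3) → TDChromatic (Central (suc n) (wheelAdj n)) ((2 * n) / 3 + 3)) ×
    (¬ ((n % 3 ≡ 0) × (n ≢ 3)) → TDChromatic (Central (suc n) (wheelAdj n)) ((2 * n) / 3 + 4))
proposition5p3 1 (s≤s ())
proposition5p3 2 (s≤s (s≤s ()))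
proposition5p3 3 _ = (λ (_ , 3≢3) → ⊥-elim (3≢3 refl)) , (λ _ → wheel₃-χ)
proposition5p3 n@(suc (suc (suc (suc k)))) _ =
  (λ (r≡0 , _) → subst (TDChromatic G) (sym (proj₁ (χ-formula n) r≡0)) (wheel-χ k)) ,
  (λ ¬case → subst (TDChromatic G) (sym (proj₂ (χ-formula n) (λ r≡0 → ¬case (r≡0 , λ ())))) (wheel-χ k))
  where
  G = Central (suc n) (wheelAdj n)
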